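{- For every positive integer $n$, \[ q(n) = L+\sum_{k=1}^\infty (-1)^{k+1} \Big( q\big( \tfrac{2n-P_{5,k}}{2}\big) +q\big( \tfrac{2n-Q_{5,k}}{2}\big) \Big), \] where $L=-1$ if $2n=\Delta_{4k+1}$ or $2n=\Delta_{4k+2}$ for some integer $k\ge0$; $L=1$ if $2n=\Delta_{4k+3}$ or $2n=\Delta_{4k+4}$ for some integer $k\ge 0$; and $L=0$ otherwise. Here $\Delta_j=j(j+1)/2$, $P_{5,k}=\frac{k(3k-1)}{2}$, $Q_{5,k}=\frac{k(3k+1)}{2}$.
   Context: $q(n)$ is the number of partitions of $n$ into distinct parts ($q(0)=1$), extended to all rational $x$ by $q(x)=0$ whenever $x\notin\mathbb{N}_0$ (in particular for non-integers and negatives). -}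

module Defs where

open import Data.Nat using (ℕ; zero; suc; _+_; _*_; _∸_; _≤?_)
open import Data.Nat.DivMod using (_/_)
open import Data.Integer as ℤ using (ℤ; +_; -[1+_])
open import Data.Rational using (ℚ; mkℚ)
open import Data.List using (List; []; _∷_; [_]; _++_; map; length)
open import Relation.Nullary.Decidable using (yes; no)

-- dparts n m : the list of all partitions of n into distinct parts,
-- each part in {1,…,m}, each partition written as a strictly
-- decreasing list of positive integers.
dparts : ℕ → ℕ → List (List ℕ)
dparts zero    m       = [ [] ]
dparts (suc n) zero    = []
dparts (suc n) (suc m) with suc m ≤? suc n
... | yes _ = dparts (suc n) m ++ map (suc m ∷_) (dparts (suc n ∸ suc m) m)
... | no  _ = dparts (suc n) m

q : ℕ → ℕ
q n = length (dparts n n)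

-- Extension to rationals: q x = 0 unless x is a nonnegative integer.
qℚ : ℚ → ℕ
qℚ (mkℚ (+ m)     zero    _) = q m
qℚ (mkℚ (+ m)     (suc _) _) = 0
qℚ (mkℚ -[1+ _ ]  _       _) = 0

Δ : ℕ → ℕ
Δ j = (j * suc j) / 2

P5 : ℕ → ℕ
P5 k = (k * (3 * k ∸ 1)) / 2

Q5 : ℕ → ℕ
Q5 k = (k * (3 * k + 1)) / 2

half : ℕ → ℕ → ℚ
half n a = Data.Rational._/_ ((+ (2 * n)) ℤ.- (+ a)) 2

sgn : ℕ → ℤ
sgn zero          = ℤ.- (+ 1)
sgn (suc zero)    = + 1
sgn (suc (suc k)) = sgn k

term : ℕ → ℕ → ℤ
term n k = sgn k ℤ.* (+ (qℚ (half n (P5 k)) + qℚ (half n (Q5 k))))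

partialSum : ℕ → ℕ → ℤ
partialSum n zero    = + 0
partialSum n (suc N) = partialSum n N ℤ.+ term n (suc N)

-- Write D(x) = ∏_{i≥1} (1 + x^{2i}) = Σ_y q(y) x^{2y}. By Euler's pentagonal number theorem,
-- ∏_{k≥1} (1 - x^k) = 1 + Σ_{k≥1} (-1)^k (x^{P_k} + x^{Q_k}), so q(n) minus the series is the
-- coefficient of x^{2n} in ∏ (1 - x^k) · D(x). Separate the odd and even factors of
-- ∏ (1 - x^k). Gauss's identity, in the form ∏ (1 - x^{2i}) = ∏ (1 + x^{2i-1}) · Θ(x) with
-- Θ(x) = 1 + Σ_{j≥0} (-1)^{j+1} (x^{Δ_{2j+1}} + x^{Δ_{2j+2}}), then turns ∏ (1 - x^k) · D(x) into
-- ∏ (1 - x^{4i-2}) ∏ (1 + x^{2i}) · Θ(x), and the first two products cancel (Euler's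
-- odd-versus-distinct identity). What remains is Θ(x), whose coefficient of x^{2n} is L.
--
-- Power series are sequences ℕ → ℤ, and multiplication by a polynomial is an operator on them.
-- Each infinite identity is replaced by an exact finite one (Shanks' form of the pentagonal
-- theorem, an analogous form of Gauss's identity, and finite products) agreeing with it in all
-- degrees that matter.

module Submission where

open import Data.Empty using (⊥-elim)
open import Data.Integer as ℤ using (ℤ; +_; -[1+_]; -1ℤ)
import Data.Integer.Properties as ℤₚ
open import Data.Integer.Tactic.RingSolver using (solve-∀)
open import Data.List using (_∷_; length)
import Data.List.Properties as Listₚ
open import Data.Nat using (ℕ; zero; suc; _+_; _*_; _∸_; _≤_; _<_; z≤n; s≤s)
open import Data.Nat.Coprimality using (Coprime; coprime-+; 1-coprimeTo; coprime⇒gcd≡1)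
open import Data.Nat.DivMod using (_/_; m*n/n≡m)
open import Data.Nat.GCD using (gcd; c*gcd[m,n]≡gcd[cm,cn]; gcd-zeroʳ)
import Data.Nat.Properties as ℕₚ
import Data.Nat.Tactic.RingSolver as ℕ-Ring
open import Data.Product using (∃; _×_; _,_; proj₁; proj₂)
open import Data.Rational as ℚ using (mkℚ; ↥_; ↧_)
import Data.Rational.Properties as ℚₚ
open import Data.Sum as Sum using (_⊎_; inj₁; inj₂; [_,_]′)
open import Function using (_∘_)
open import Relation.Binary.PropositionalEquality
  using (_≡_; _≢_; refl; sym; trans; cong; cong₂; subst; module ≡-Reasoning)
open import Relation.Nullary using (¬_)
open import Relation.Nullary.Decidable using (yes; no)

open import Defs

-- Power series and multiplication operators

Series : Set
Series = ℕ → ℤ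

Op : Set
Op = Series → Series

shift : ℕ → Op
shift zero    f         = f
shift (suc e) f zero    = + 0
shift (suc e) f (suc t) = shift e f t

_⊕_ : Series → Series → Series
(f ⊕ g) t = f t ℤ.+ g t

_⊙_ : ℤ → Series → Series
(z ⊙ f) t = z ℤ.* f t

infixl 6 _⊕_
infixr 7 _⊙_

1-x^ : ℕ → Op
1-x^ a f = f ⊕ -1ℤ ⊙ shift a f

1+x^ : ℕ → Op
1+x^ a f = f ⊕ shift a f

one : Series
one zero    = + 1
one (suc t) = + 0

shift-below : ∀ e f t → t < e → shift e f t ≡ + 0
shift-below (suc e) f zero    _       = refl
shift-below (suc e) f (suc t) (s≤s p) = shift-below e f t p

shift-+ : ∀ e f t → shift e f (e + t) ≡ f t
shift-+ zero    f t = refl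
shift-+ (suc e) f t = shift-+ e f t

shift-above : ∀ e f t → e ≤ t → shift e f t ≡ f (t ∸ e)
shift-above e f t e≤t =
  trans (cong (shift e f) (sym (ℕₚ.m+[n∸m]≡n e≤t))) (shift-+ e f (t ∸ e))

shift-shift : ∀ a b f t → shift a (shift b f) t ≡ shift (a + b) f t
shift-shift zero    b f t       = refl
shift-shift (suc a) b f zero    = refl
shift-shift (suc a) b f (suc t) = shift-shift a b f t

shift-comm : ∀ a b f t → shift a (shift b f) t ≡ shift b (shift a f) t
shift-comm a b f t = begin
  shift a (shift b f) t ≡⟨ shift-shift a b f t ⟩
  shift (a + b) f t     ≡⟨ cong (λ e → shift e f t) (ℕₚ.+-comm a b) ⟩
  shift (b + a) f t     ≡⟨ shift-shift b a f t ⟨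
  shift b (shift a f) t ∎
  where open ≡-Reasoning

shift-⊕ : ∀ e f g t → shift e (f ⊕ g) t ≡ shift e f t ℤ.+ shift e g t
shift-⊕ zero    f g t       = refl
shift-⊕ (suc e) f g zero    = refl
shift-⊕ (suc e) f g (suc t) = shift-⊕ e f g t

shift-⊙ : ∀ e z f t → shift e (z ⊙ f) t ≡ z ℤ.* shift e f t
shift-⊙ zero    z f t       = refl
shift-⊙ (suc e) z f zero    = sym (ℤₚ.*-zeroʳ z)
shift-⊙ (suc e) z f (suc t) = shift-⊙ e z f t

shift-causal : ∀ e t {f g} → (∀ s → s ≤ t → f s ≡ g s) → shift e f t ≡ shift e g t
shift-causal zero    t       f≈g = f≈g t ℕₚ.≤-refl
shift-causal (suc e) zero    f≈g = refl
shift-causal (suc e) (suc t) f≈g = shift-causal e t (λ s s≤t → f≈g s (ℕₚ.m≤n⇒m≤1+n s≤t))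

shift-one : ∀ e → shift e one e ≡ + 1
shift-one zero    = refl
shift-one (suc e) = shift-one e

shift-one-≢ : ∀ e t → t ≢ e → shift e one t ≡ + 0
shift-one-≢ zero    zero    t≢e = ⊥-elim (t≢e refl)
shift-one-≢ zero    (suc t) t≢e = refl
shift-one-≢ (suc e) zero    t≢e = refl
shift-one-≢ (suc e) (suc t) t≢e = shift-one-≢ e t (t≢e ∘ cong suc)

-- Multiplication by a power series, characterised without defining the convolution product.
-- Operators built from shifts commute with every multiplier (IsCentral); that is all the
-- commutativity the argument uses.
record IsMultiplier (A : Op) : Set where
  field
    causal          : ∀ t {f g} → (∀ s → s ≤ t → f s ≡ g s) → A f t ≡ A g t
    additive        : ∀ f g t → A (f ⊕ g) t ≡ A f t ℤ.+ A g t
    homogeneous     : ∀ z f t → A (z ⊙ f) t ≡ z ℤ.* A f t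
    shift-invariant : ∀ e f t → A (shift e f) t ≡ shift e (A f) t

  respects : ∀ {f g} → (∀ s → f s ≡ g s) → ∀ t → A f t ≡ A g t
  respects f≈g t = causal t (λ s _ → f≈g s)

open IsMultiplier

id-multiplier : IsMultiplier (λ f → f)
id-multiplier = record
  { causal          = λ t f≈g → f≈g t ℕₚ.≤-refl
  ; additive        = λ f g t → refl
  ; homogeneous     = λ z f t → refl
  ; shift-invariant = λ e f t → refl
  }

shift-multiplier : ∀ e → IsMultiplier (shift e)
shift-multiplier e = record
  { causal          = shift-causal e
  ; additive        = shift-⊕ e
  ; homogeneous     = shift-⊙ e
  ; shift-invariant = shift-comm e
  }

∘-multiplier : ∀ {A B} → IsMultiplier A → IsMultiplier B → IsMultiplier (A ∘ B)
∘-multiplier {A} {B} mA mB = record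
  { causal          = λ t f≈g → causal mA t (λ s s≤t → causal mB s (λ r r≤s → f≈g r (ℕₚ.≤-trans r≤s s≤t)))
  ; additive        = λ f g t → trans (respects mA (additive mB f g) t) (additive mA (B f) (B g) t)
  ; homogeneous     = λ z f t → trans (respects mA (homogeneous mB z f) t) (homogeneous mA z (B f) t)
  ; shift-invariant = λ e f t → trans (respects mA (shift-invariant mB e f) t) (shift-invariant mA e (B f) t)
  }

⊕-multiplier : ∀ {A B} → IsMultiplier A → IsMultiplier B → IsMultiplier (λ f → A f ⊕ B f)
⊕-multiplier {A} {B} mA mB = record
  { causal          = λ t f≈g → cong₂ ℤ._+_ (causal mA t f≈g) (causal mB t f≈g)
  ; additive        = λ f g t → trans (cong₂ ℤ._+_ (additive mA f g t) (additive mB f g t))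
                                      (interchange (A f t) (A g t) (B f t) (B g t))
  ; homogeneous     = λ z f t → trans (cong₂ ℤ._+_ (homogeneous mA z f t) (homogeneous mB z f t))
                                      (sym (ℤₚ.*-distribˡ-+ z (A f t) (B f t)))
  ; shift-invariant = λ e f t → trans (cong₂ ℤ._+_ (shift-invariant mA e f t) (shift-invariant mB e f t))
                                      (sym (shift-⊕ e (A f) (B f) t))
  }
  where
  interchange : ∀ a b c d → (a ℤ.+ b) ℤ.+ (c ℤ.+ d) ≡ (a ℤ.+ c) ℤ.+ (b ℤ.+ d)
  interchange = solve-∀

⊙-multiplier : ∀ {A} z → IsMultiplier A → IsMultiplier (λ f → z ⊙ A f)
⊙-multiplier {A} z mA = record
  { causal          = λ t f≈g → cong (z ℤ.*_) (causal mA t f≈g)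
  ; additive        = λ f g t → trans (cong (z ℤ.*_) (additive mA f g t)) (ℤₚ.*-distribˡ-+ z (A f t) (A g t))
  ; homogeneous     = λ w f t → trans (cong (z ℤ.*_) (homogeneous mA w f t)) (left-commute z w (A f t))
  ; shift-invariant = λ e f t → trans (cong (z ℤ.*_) (shift-invariant mA e f t)) (sym (shift-⊙ e z (A f) t))
  }
  where
  left-commute : ∀ a b c → a ℤ.* (b ℤ.* c) ≡ b ℤ.* (a ℤ.* c)
  left-commute = solve-∀

1-x^-multiplier : ∀ a → IsMultiplier (1-x^ a)
1-x^-multiplier a = ⊕-multiplier id-multiplier (⊙-multiplier -1ℤ (shift-multiplier a))

1+x^-multiplier : ∀ a → IsMultiplier (1+x^ a)
1+x^-multiplier a = ⊕-multiplier id-multiplier (shift-multiplier a)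

record IsCentral (A : Op) : Set where
  field
    multiplier : IsMultiplier A
    commutes   : ∀ {G} → IsMultiplier G → ∀ f t → A (G f) t ≡ G (A f) t

open IsCentral

id-central : IsCentral (λ f → f)
id-central = record { multiplier = id-multiplier ; commutes = λ _ _ _ → refl }

∘-central : ∀ {A B} → IsCentral A → IsCentral B → IsCentral (A ∘ B)
∘-central {A} {B} cA cB = record
  { multiplier = ∘-multiplier (multiplier cA) (multiplier cB)
  ; commutes   = λ mG f t → trans (respects (multiplier cA) (commutes cB mG f) t) (commutes cA mG (B f) t)
  }

1-x^-central : ∀ a → IsCentral (1-x^ a)
1-x^-central a = record
  { multiplier = 1-x^-multiplier a
  ; commutes   = λ {G} mG f t → sym (begin
      G (f ⊕ -1ℤ ⊙ shift a f) t               ≡⟨ additive mG f _ t ⟩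
      G f t ℤ.+ G (-1ℤ ⊙ shift a f) t         ≡⟨ cong (λ x → G f t ℤ.+ x) (homogeneous mG -1ℤ (shift a f) t) ⟩
      G f t ℤ.+ -1ℤ ℤ.* G (shift a f) t       ≡⟨ cong (λ x → G f t ℤ.+ -1ℤ ℤ.* x) (shift-invariant mG a f t) ⟩
      G f t ℤ.+ -1ℤ ℤ.* shift a (G f) t       ∎)
  }
  where open ≡-Reasoning

1+x^-central : ∀ a → IsCentral (1+x^ a)
1+x^-central a = record
  { multiplier = 1+x^-multiplier a
  ; commutes   = λ {G} mG f t →
      sym (trans (additive mG f (shift a f) t) (cong (λ x → G f t ℤ.+ x) (shift-invariant mG a f t)))
  }

-- Finite products and alternating sums

-- prodAfter φ k l = φ (k+1) ∘ ⋯ ∘ φ (k+l), and prodBetween φ k m = ∏_{k<i≤m} φ i.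
-- Factor families are only used from index 1 on; their value at 0 is immaterial.
prodAfter : (ℕ → Op) → ℕ → ℕ → Op
prodAfter φ k zero    = λ f → f
prodAfter φ k (suc l) = φ (suc k) ∘ prodAfter φ (suc k) l

prodAfter-central : ∀ {φ} → (∀ i → IsCentral (φ i)) → ∀ k l → IsCentral (prodAfter φ k l)
prodAfter-central cφ k zero    = id-central
prodAfter-central cφ k (suc l) = ∘-central (cφ (suc k)) (prodAfter-central cφ (suc k) l)

prodAfter-suc : ∀ {φ} → (∀ i → IsCentral (φ i)) → ∀ k l f t →
                prodAfter φ k (suc l) f t ≡ φ (suc (k + l)) (prodAfter φ k l f) t
prodAfter-suc {φ} cφ k zero    f t = cong (λ i → φ (suc i) f t) (sym (ℕₚ.+-identityʳ k))
prodAfter-suc {φ} cφ k (suc l) f t = begin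
  φ (suc k) (prodAfter φ (suc k) (suc l) f) t
    ≡⟨ respects (multiplier (cφ (suc k))) (prodAfter-suc cφ (suc k) l f) t ⟩
  φ (suc k) (φ (suc (suc k + l)) (prodAfter φ (suc k) l f)) t
    ≡⟨ commutes (cφ (suc k)) (multiplier (cφ (suc (suc k + l)))) (prodAfter φ (suc k) l f) t ⟩
  φ (suc (suc k + l)) (prodAfter φ k (suc l) f) t
    ≡⟨ cong (λ i → φ (suc i) (prodAfter φ k (suc l) f) t) (sym (ℕₚ.+-suc k l)) ⟩
  φ (suc (k + suc l)) (prodAfter φ k (suc l) f) t ∎
  where open ≡-Reasoning

prodBetween : (ℕ → Op) → ℕ → ℕ → Op
prodBetween φ k m = prodAfter φ k (m ∸ k)

prodBetween-empty : ∀ φ m f t → prodBetween φ m m f t ≡ f t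
prodBetween-empty φ m f t rewrite ℕₚ.n∸n≡0 m = refl

prodBetween-lower : ∀ φ j m → j < m → ∀ f t →
                    prodBetween φ j m f t ≡ φ (suc j) (prodBetween φ (suc j) m f) t
prodBetween-lower φ j m j<m f t rewrite ℕₚ.+-∸-assoc 1 j<m = refl

prodBetween-upper : ∀ {φ} → (∀ i → IsCentral (φ i)) → ∀ k m → k ≤ m → ∀ f t →
                    prodBetween φ k (suc m) f t ≡ φ (suc m) (prodBetween φ k m f) t
prodBetween-upper {φ} cφ k m k≤m f t rewrite ℕₚ.+-∸-assoc 1 k≤m =
  trans (prodAfter-suc cφ k (m ∸ k) f t)
        (cong (λ i → φ (suc i) (prodAfter φ k (m ∸ k) f) t) (ℕₚ.m+[n∸m]≡n k≤m))

-1^_ : ℕ → ℤ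
-1^ zero  = + 1
-1^ suc k = ℤ.- (-1^ k)

-1^-even : ∀ k → -1^ (k + k) ≡ + 1
-1^-even zero    = refl
-1^-even (suc k) = trans (cong (λ i → -1^ suc i) (ℕₚ.+-suc k k))
                         (trans (ℤₚ.neg-involutive (-1^ (k + k))) (-1^-even k))

altSum : (ℕ → ℤ) → ℕ → ℤ
altSum a zero    = a 0
altSum a (suc m) = altSum a m ℤ.+ -1^ suc m ℤ.* a (suc m)

altSum-cong : ∀ a b m → (∀ k → k ≤ m → a k ≡ b k) → altSum a m ≡ altSum b m
altSum-cong a b zero    a≈b = a≈b 0 z≤n
altSum-cong a b (suc m) a≈b =
  cong₂ ℤ._+_ (altSum-cong a b m (λ k k≤m → a≈b k (ℕₚ.m≤n⇒m≤1+n k≤m)))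
              (cong (-1^ suc m ℤ.*_) (a≈b (suc m) ℕₚ.≤-refl))

altSum-+ : ∀ a b m → altSum (λ k → a k ℤ.+ b k) m ≡ altSum a m ℤ.+ altSum b m
altSum-+ a b zero    = refl
altSum-+ a b (suc m) =
  trans (cong (λ x → x ℤ.+ -1^ suc m ℤ.* (a (suc m) ℤ.+ b (suc m))) (altSum-+ a b m))
        (regroup (altSum a m) (altSum b m) (-1^ suc m) (a (suc m)) (b (suc m)))
  where
  regroup : ∀ A B s x y → A ℤ.+ B ℤ.+ s ℤ.* (x ℤ.+ y) ≡ (A ℤ.+ s ℤ.* x) ℤ.+ (B ℤ.+ s ℤ.* y)
  regroup = solve-∀

altSum-* : ∀ z a m → altSum (λ k → z ℤ.* a k) m ≡ z ℤ.* altSum a m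
altSum-* z a zero    = refl
altSum-* z a (suc m) =
  trans (cong (λ x → x ℤ.+ -1^ suc m ℤ.* (z ℤ.* a (suc m))) (altSum-* z a m))
        (factor z (altSum a m) (-1^ suc m) (a (suc m)))
  where
  factor : ∀ z A s x → z ℤ.* A ℤ.+ s ℤ.* (z ℤ.* x) ≡ z ℤ.* (A ℤ.+ s ℤ.* x)
  factor = solve-∀

altSum-minus : ∀ a b m → altSum (λ k → a k ℤ.+ -1ℤ ℤ.* b k) m ≡ altSum a m ℤ.+ -1ℤ ℤ.* altSum b m
altSum-minus a b m =
  trans (altSum-+ a (λ k → -1ℤ ℤ.* b k) m) (cong (λ x → altSum a m ℤ.+ x) (altSum-* -1ℤ b m))

prev : (ℕ → ℤ) → ℕ → ℤ
prev w zero    = + 0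
prev w (suc k) = w k

altSum-telescope : ∀ w m → altSum (λ k → w k ℤ.+ prev w k) m ≡ -1^ m ℤ.* w m
altSum-telescope w zero    = trans (ℤₚ.+-identityʳ (w 0)) (sym (ℤₚ.*-identityˡ (w 0)))
altSum-telescope w (suc m) =
  trans (cong (λ x → x ℤ.+ -1^ suc m ℤ.* (w (suc m) ℤ.+ w m)) (altSum-telescope w m))
        (cancel (-1^ m) (w m) (w (suc m)))
  where
  cancel : ∀ s a b → s ℤ.* a ℤ.+ (ℤ.- s) ℤ.* (b ℤ.+ a) ≡ (ℤ.- s) ℤ.* b
  cancel = solve-∀

altSum-head : ∀ a m → (∀ k → a (suc k) ≡ + 0) → altSum a m ≡ a 0
altSum-head a zero    _    = refl
altSum-head a (suc m) tail≡0 =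
  trans (cong₂ ℤ._+_ (altSum-head a m tail≡0)
                     (trans (cong (-1^ suc m ℤ.*_) (tail≡0 m)) (ℤₚ.*-zeroʳ (-1^ suc m))))
        (ℤₚ.+-identityʳ (a 0))

altSeries : (ℕ → Series) → ℕ → Series
altSeries F zero    = F 0
altSeries F (suc m) = altSeries F m ⊕ -1^ suc m ⊙ F (suc m)

altSeries-coeff : ∀ F m t → altSeries F m t ≡ altSum (λ k → F k t) m
altSeries-coeff F zero    t = refl
altSeries-coeff F (suc m) t = cong (λ x → x ℤ.+ -1^ suc m ℤ.* F (suc m) t) (altSeries-coeff F m t)

multiplier-altSeries : ∀ {A} → IsMultiplier A → ∀ F m t → A (altSeries F m) t ≡ altSum (λ k → A (F k) t) m
multiplier-altSeries mA F zero    t = refl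
multiplier-altSeries mA F (suc m) t =
  trans (additive mA (altSeries F m) (-1^ suc m ⊙ F (suc m)) t)
        (cong₂ ℤ._+_ (multiplier-altSeries mA F m t) (homogeneous mA (-1^ suc m) (F (suc m)) t))

-- Shanks' finite form of the pentagonal number theorem

tri : ℕ → ℕ
tri zero    = 0
tri (suc k) = suc k + tri k

shanksExp : ℕ → ℕ → ℕ
shanksExp m k = m * k + tri k

-- tri k = Δ_k, pentP k = k(3k-1)/2 and pentQ k = k(3k+1)/2.
pentP : ℕ → ℕ
pentP zero    = 0
pentP (suc m) = suc (m + m) + (m * m + tri m)

pentQ : ℕ → ℕ
pentQ k = k * k + tri k

shanksExp-sucˡ : ∀ m k → shanksExp (suc m) k ≡ k + shanksExp m k
shanksExp-sucˡ m k = lemma m k (tri k)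
  where
  lemma : ∀ m k x → k + m * k + x ≡ k + (m * k + x)
  lemma = ℕ-Ring.solve-∀

shanksExp-sucʳ : ∀ m j → shanksExp m (suc j) ≡ suc m + j + shanksExp m j
shanksExp-sucʳ m j = lemma m j (tri j)
  where
  lemma : ∀ m j x → m * suc j + (suc j + x) ≡ suc m + j + (m * j + x)
  lemma = ℕ-Ring.solve-∀

eulerFactors : ℕ → ℕ → Op
eulerFactors = prodBetween 1-x^

eulerFactors-multiplier : ∀ k m → IsMultiplier (eulerFactors k m)
eulerFactors-multiplier k m = multiplier (prodAfter-central 1-x^-central k (m ∸ k))

-- Shanks: Σ_{k≤m} (-1)^k ∏_{k<i≤m} (1 - x^i) x^{mk+Δ_k} = 1 + Σ_{1≤k≤m} (-1)^k (x^{Q_k} + x^{P_k}).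
shanksSum : ℕ → Op
shanksSum m h = altSeries (λ k → eulerFactors k m (shift (shanksExp m k) h)) m

pentagonalSum : ℕ → Op
pentagonalSum zero    h = h
pentagonalSum (suc m) h = pentagonalSum m h ⊕ -1^ suc m ⊙ (shift (pentQ (suc m)) h ⊕ shift (pentP (suc m)) h)

-- From m to m + 1 every product gains the factor 1 - x^{m+1} and every monomial the factor x^k;
-- the surplus terms telescope, leaving the new pentagonal terms.
module ShanksStep (m : ℕ) (h : Series) (t : ℕ) where
  summand summand′ : ℕ → Series
  summand  k = eulerFactors k m       (shift (shanksExp m k) h)
  summand′ k = eulerFactors k (suc m) (shift (shanksExp (suc m) k) h)

  boundary : ℕ → ℤ
  boundary k = shift (suc m + k) (summand k) t

  shifted-summand : ∀ k s → eulerFactors k m (shift (shanksExp (suc m) k) h) s ≡ shift k (summand k) s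
  shifted-summand k s =
    trans (respects (eulerFactors-multiplier k m)
                    (λ r → trans (cong (λ e → shift e h r) (shanksExp-sucˡ m k)) (sym (shift-shift k (shanksExp m k) h r))) s)
          (shift-invariant (eulerFactors-multiplier k m) k (shift (shanksExp m k) h) s)

  boundary-prev : ∀ k → k ≤ m → shift k (summand k) t ≡ summand k t ℤ.+ -1ℤ ℤ.* prev boundary k
  boundary-prev zero    _    = sym (trans (cong (λ x → summand 0 t ℤ.+ x) (ℤₚ.*-zeroʳ -1ℤ)) (ℤₚ.+-identityʳ (summand 0 t)))
  boundary-prev (suc j) j<m =
    trans (sub-sub (summand (suc j) t) (shift (suc j) (summand (suc j)) t))
          (cong (λ x → summand (suc j) t ℤ.+ -1ℤ ℤ.* x) (sym boundary≡))
    where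
    sub-sub : ∀ a b → b ≡ a ℤ.+ -1ℤ ℤ.* (a ℤ.+ -1ℤ ℤ.* b)
    sub-sub = solve-∀
    boundary≡ : boundary j ≡ 1-x^ (suc j) (summand (suc j)) t
    boundary≡ = begin
      shift (suc m + j) (summand j) t
        ≡⟨ shift-invariant (eulerFactors-multiplier j m) (suc m + j) (shift (shanksExp m j) h) t ⟨
      eulerFactors j m (shift (suc m + j) (shift (shanksExp m j) h)) t
        ≡⟨ respects (eulerFactors-multiplier j m)
             (λ r → trans (shift-shift (suc m + j) (shanksExp m j) h r)
                          (cong (λ e → shift e h r) (sym (shanksExp-sucʳ m j)))) t ⟩
      eulerFactors j m (shift (shanksExp m (suc j)) h) t
        ≡⟨ prodBetween-lower 1-x^ j m j<m (shift (shanksExp m (suc j)) h) t ⟩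
      1-x^ (suc j) (summand (suc j)) t ∎
      where open ≡-Reasoning

  summand′-telescopes : ∀ k → k ≤ m → summand′ k t ≡ summand k t ℤ.+ -1ℤ ℤ.* (boundary k ℤ.+ prev boundary k)
  summand′-telescopes k k≤m = begin
    summand′ k t
      ≡⟨ prodBetween-upper 1-x^-central k m k≤m (shift (shanksExp (suc m) k) h) t ⟩
    1-x^ (suc m) (eulerFactors k m (shift (shanksExp (suc m) k) h)) t
      ≡⟨ cong₂ (λ x y → x ℤ.+ -1ℤ ℤ.* y) (shifted-summand k t)
           (trans (shift-causal (suc m) t (λ s _ → shifted-summand k s)) (shift-shift (suc m) k (summand k) t)) ⟩
    shift k (summand k) t ℤ.+ -1ℤ ℤ.* boundary k
      ≡⟨ cong (λ x → x ℤ.+ -1ℤ ℤ.* boundary k) (boundary-prev k k≤m) ⟩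
    summand k t ℤ.+ -1ℤ ℤ.* prev boundary k ℤ.+ -1ℤ ℤ.* boundary k
      ≡⟨ regroup (summand k t) (prev boundary k) (boundary k) ⟩
    summand k t ℤ.+ -1ℤ ℤ.* (boundary k ℤ.+ prev boundary k) ∎
    where
    open ≡-Reasoning
    regroup : ∀ a b c → a ℤ.+ -1ℤ ℤ.* b ℤ.+ -1ℤ ℤ.* c ≡ a ℤ.+ -1ℤ ℤ.* (c ℤ.+ b)
    regroup = solve-∀

  last-boundary : boundary m ≡ shift (pentP (suc m)) h t
  last-boundary = trans (shift-causal (suc m + m) t (λ s _ → prodBetween-empty 1-x^ m (shift (shanksExp m m) h) s))
                       (shift-shift (suc m + m) (shanksExp m m) h t)

  step : altSeries summand′ m t ≡ altSeries summand m t ℤ.+ -1^ suc m ℤ.* shift (pentP (suc m)) h t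
  step = begin
    altSeries summand′ m t
      ≡⟨ altSeries-coeff summand′ m t ⟩
    altSum (λ k → summand′ k t) m
      ≡⟨ altSum-cong _ _ m summand′-telescopes ⟩
    altSum (λ k → summand k t ℤ.+ -1ℤ ℤ.* (boundary k ℤ.+ prev boundary k)) m
      ≡⟨ altSum-minus (λ k → summand k t) (λ k → boundary k ℤ.+ prev boundary k) m ⟩
    altSum (λ k → summand k t) m ℤ.+ -1ℤ ℤ.* altSum (λ k → boundary k ℤ.+ prev boundary k) m
      ≡⟨ cong₂ (λ x y → x ℤ.+ -1ℤ ℤ.* y) (sym (altSeries-coeff summand m t)) (altSum-telescope boundary m) ⟩
    altSeries summand m t ℤ.+ -1ℤ ℤ.* (-1^ m ℤ.* boundary m)
      ≡⟨ regroup (altSeries summand m t) (-1^ m) (boundary m) ⟩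
    altSeries summand m t ℤ.+ -1^ suc m ℤ.* boundary m
      ≡⟨ cong (λ x → altSeries summand m t ℤ.+ -1^ suc m ℤ.* x) last-boundary ⟩
    altSeries summand m t ℤ.+ -1^ suc m ℤ.* shift (pentP (suc m)) h t ∎
    where
    open ≡-Reasoning
    regroup : ∀ a s x → a ℤ.+ -1ℤ ℤ.* (s ℤ.* x) ≡ a ℤ.+ (ℤ.- s) ℤ.* x
    regroup = solve-∀

shanks-identity : ∀ m h t → shanksSum m h t ≡ pentagonalSum m h t
shanks-identity zero    h t = refl
shanks-identity (suc m) h t = begin
  altSeries summand′ m t ℤ.+ -1^ suc m ℤ.* summand′ (suc m) t
    ≡⟨ cong (λ x → x ℤ.+ -1^ suc m ℤ.* summand′ (suc m) t) step ⟩
  shanksSum m h t ℤ.+ s ℤ.* P ℤ.+ s ℤ.* summand′ (suc m) t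
    ≡⟨ cong₂ (λ x y → x ℤ.+ s ℤ.* P ℤ.+ s ℤ.* y) (shanks-identity m h t) (prodBetween-empty 1-x^ (suc m) _ t) ⟩
  pentagonalSum m h t ℤ.+ s ℤ.* P ℤ.+ s ℤ.* shift (shanksExp (suc m) (suc m)) h t
    ≡⟨ regroup (pentagonalSum m h t) s P (shift (pentQ (suc m)) h t) ⟩
  pentagonalSum (suc m) h t ∎
  where
  open ShanksStep m h t
  open ≡-Reasoning
  s = -1^ suc m
  P = shift (pentP (suc m)) h t
  regroup : ∀ r s p q → r ℤ.+ s ℤ.* p ℤ.+ s ℤ.* q ≡ r ℤ.+ s ℤ.* (q ℤ.+ p)
  regroup = solve-∀

eulerProd : ℕ → Op
eulerProd = prodAfter 1-x^ 0

eulerProd≈pentagonalSum : ∀ N h t → t ≤ N → eulerProd N h t ≡ pentagonalSum N h t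
eulerProd≈pentagonalSum N h t t≤N = begin
  eulerProd N h t
    ≡⟨ respects (eulerFactors-multiplier 0 N) (λ r → cong (λ e → shift e h r) exp0) t ⟨
  summand 0 t
    ≡⟨ altSum-head (λ k → summand k t) N vanish ⟨
  altSum (λ k → summand k t) N
    ≡⟨ altSeries-coeff summand N t ⟨
  shanksSum N h t
    ≡⟨ shanks-identity N h t ⟩
  pentagonalSum N h t ∎
  where
  open ≡-Reasoning
  summand : ℕ → Series
  summand k = eulerFactors k N (shift (shanksExp N k) h)
  exp0 : shanksExp N 0 ≡ 0
  exp0 = trans (ℕₚ.+-identityʳ (N * 0)) (ℕₚ.*-zeroʳ N)
  vanish : ∀ k → summand (suc k) t ≡ + 0
  vanish k = trans (shift-invariant (eulerFactors-multiplier (suc k) N) (shanksExp N (suc k)) h t)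
                   (shift-below _ _ t (ℕₚ.<-≤-trans (s≤s t≤N) N<exp))
    where
    N<exp : suc N ≤ shanksExp N (suc k)
    N<exp = subst (suc N ≤_) (sym (ℕₚ.+-suc (N * suc k) (k + tri k)))
                  (s≤s (ℕₚ.≤-trans (ℕₚ.m≤m*n N (suc k)) (ℕₚ.m≤m+n (N * suc k) (k + tri k))))

pentagonalSum-suc-high : ∀ m h t → t ≤ m → pentagonalSum (suc m) h t ≡ pentagonalSum m h t
pentagonalSum-suc-high m h t t≤m = begin
  pentagonalSum m h t ℤ.+ -1^ suc m ℤ.* (shift (pentQ (suc m)) h t ℤ.+ shift (pentP (suc m)) h t)
    ≡⟨ cong (λ x → pentagonalSum m h t ℤ.+ -1^ suc m ℤ.* x)
            (cong₂ ℤ._+_ (shift-below _ h t (ℕₚ.<-≤-trans (s≤s t≤m) m<pentQ)) (shift-below _ h t (ℕₚ.<-≤-trans (s≤s t≤m) m<pentP))) ⟩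
  pentagonalSum m h t ℤ.+ -1^ suc m ℤ.* + 0
    ≡⟨ trans (cong (λ x → pentagonalSum m h t ℤ.+ x) (ℤₚ.*-zeroʳ (-1^ suc m))) (ℤₚ.+-identityʳ _) ⟩
  pentagonalSum m h t ∎
  where
  open ≡-Reasoning
  m<pentQ : suc m ≤ pentQ (suc m)
  m<pentQ = s≤s (ℕₚ.≤-trans (ℕₚ.m≤m+n m (m * suc m)) (ℕₚ.m≤m+n _ _))
  m<pentP : suc m ≤ pentP (suc m)
  m<pentP = s≤s (ℕₚ.≤-trans (ℕₚ.m≤m+n m m) (ℕₚ.m≤m+n _ _))

pentagonalSum-stable : ∀ N h t → t ≤ N → pentagonalSum N h t ≡ pentagonalSum t h t
pentagonalSum-stable zero    h zero    _ = refl
pentagonalSum-stable (suc N) h t t≤1+N with ℕₚ.m≤n⇒m<n∨m≡n t≤1+N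
... | inj₁ (s≤s t≤N) = trans (pentagonalSum-suc-high N h t t≤N) (pentagonalSum-stable N h t t≤N)
... | inj₂ refl      = refl

-- A finite form of Gauss's identity

minusEven : ℕ → Op
minusEven i = 1-x^ (i + i)

plusOdd : ℕ → Op
plusOdd zero    = 1+x^ 0
plusOdd (suc i) = 1+x^ (suc (i + i))

minusEven-central : ∀ i → IsCentral (minusEven i)
minusEven-central i = 1-x^-central (i + i)

plusOdd-central : ∀ i → IsCentral (plusOdd i)
plusOdd-central zero    = 1+x^-central 0
plusOdd-central (suc i) = 1+x^-central (suc (i + i))

gaussFactors : ℕ → ℕ → Op
gaussFactors n k = prodBetween minusEven k n

gaussFactors-central : ∀ n k → IsCentral (gaussFactors n k)
gaussFactors-central n k = prodAfter-central minusEven-central k (n ∸ k)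

plusOddProd : ℕ → Op
plusOddProd = prodAfter plusOdd 0

plusOddProd-central : ∀ k → IsCentral (plusOddProd k)
plusOddProd-central = prodAfter-central plusOdd-central 0

plusOddProd-suc : ∀ k f t → plusOddProd (suc k) f t ≡ 1+x^ (suc (k + k)) (plusOddProd k f) t
plusOddProd-suc = prodAfter-suc plusOdd-central 0

gaussExp : ℕ → ℕ → ℕ
gaussExp n k = k * suc (n + n)

gaussExp-suc : ∀ n k → gaussExp (suc n) k ≡ (k + k) + gaussExp n k
gaussExp-suc = lemma
  where
  lemma : ∀ n k → k * suc (suc n + suc n) ≡ (k + k) + k * suc (n + n)
  lemma = ℕ-Ring.solve-∀

-- triOdd j = Δ_{2j+1} and triEven j = Δ_{2j+2}.
triOdd triEven : ℕ → ℕ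
triOdd  j = suc j * suc (j + j)
triEven j = suc j * suc (suc (suc (j + j)))

theta : ℕ → Op
theta zero    h = h
theta (suc n) h = theta n h ⊕ -1^ suc n ⊙ (shift (triOdd n) h ⊕ shift (triEven n) h)

theta-multiplier : ∀ n → IsMultiplier (theta n)
theta-multiplier zero    = id-multiplier
theta-multiplier (suc n) =
  ⊕-multiplier (theta-multiplier n)
               (⊙-multiplier (-1^ suc n) (⊕-multiplier (shift-multiplier (triOdd n)) (shift-multiplier (triEven n))))

-- Σ_{k≤n} (-1)^k ∏_{k<i≤n} (1 - x^{2i}) ∏_{i≤k} (1 + x^{2i-1}) x^{k(2n+1)} = ∏_{i≤n} (1 + x^{2i-1}) · Θ_n(x).
gaussSum : ℕ → Op
gaussSum n h = altSeries (λ k → gaussFactors n k (plusOddProd k (shift (gaussExp n k) h))) n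

gaussSummand-multiplier : ∀ n k → IsMultiplier (λ f → gaussFactors n k (plusOddProd k f))
gaussSummand-multiplier n k =
  ∘-multiplier (multiplier (gaussFactors-central n k)) (multiplier (plusOddProd-central k))

module GaussStep (n : ℕ) (h : Series) (t : ℕ) where
  summand summand′ : ℕ → Series
  summand  k = gaussFactors n       k (plusOddProd k (shift (gaussExp n k) h))
  summand′ k = gaussFactors (suc n) k (plusOddProd k (shift (gaussExp (suc n) k) h))

  boundary : ℕ → ℤ
  boundary k = shift (suc (n + n)) (1+x^ (suc (k + k)) (summand k)) t

  shifted-summand : ∀ k s → gaussFactors n k (plusOddProd k (shift (gaussExp (suc n) k) h)) s
                           ≡ shift (k + k) (summand k) s
  shifted-summand k s =
    trans (respects (gaussSummand-multiplier n k)
                    (λ r → trans (cong (λ e → shift e h r) (gaussExp-suc n k))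
                                 (sym (shift-shift (k + k) (gaussExp n k) h r))) s)
          (shift-invariant (gaussSummand-multiplier n k) (k + k) (shift (gaussExp n k) h) s)

  boundary-prev : ∀ k → k ≤ n → shift (k + k) (summand k) t ≡ summand k t ℤ.+ -1ℤ ℤ.* prev boundary k
  boundary-prev zero    _    =
    sym (trans (cong (λ x → summand 0 t ℤ.+ x) (ℤₚ.*-zeroʳ -1ℤ)) (ℤₚ.+-identityʳ (summand 0 t)))
  boundary-prev (suc j) j<n =
    trans (sub-sub (summand (suc j) t) (shift (suc j + suc j) (summand (suc j)) t))
          (cong (λ x → summand (suc j) t ℤ.+ -1ℤ ℤ.* x) (sym boundary≡))
    where
    sub-sub : ∀ a b → b ≡ a ℤ.+ -1ℤ ℤ.* (a ℤ.+ -1ℤ ℤ.* b)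
    sub-sub = solve-∀
    next : Series
    next = plusOddProd (suc j) (shift (gaussExp n (suc j)) h)
    moved : ∀ s → shift (suc (n + n)) (1+x^ (suc (j + j)) (plusOddProd j (shift (gaussExp n j) h))) s ≡ next s
    moved s = begin
      shift (suc (n + n)) (1+x^ (suc (j + j)) (plusOddProd j (shift (gaussExp n j) h))) s
        ≡⟨ shift-causal (suc (n + n)) s (λ r _ → sym (plusOddProd-suc j (shift (gaussExp n j) h) r)) ⟩
      shift (suc (n + n)) (plusOddProd (suc j) (shift (gaussExp n j) h)) s
        ≡⟨ shift-invariant (multiplier (plusOddProd-central (suc j))) (suc (n + n)) (shift (gaussExp n j) h) s ⟨
      plusOddProd (suc j) (shift (suc (n + n)) (shift (gaussExp n j) h)) s
        ≡⟨ respects (multiplier (plusOddProd-central (suc j))) (shift-shift (suc (n + n)) (gaussExp n j) h) s ⟩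
      next s ∎
      where open ≡-Reasoning
    boundary≡ : boundary j ≡ minusEven (suc j) (summand (suc j)) t
    boundary≡ = begin
      boundary j
        ≡⟨ commutes (gaussFactors-central n j)
             (∘-multiplier (shift-multiplier (suc (n + n))) (1+x^-multiplier (suc (j + j))))
             (plusOddProd j (shift (gaussExp n j) h)) t ⟨
      gaussFactors n j (shift (suc (n + n)) (1+x^ (suc (j + j)) (plusOddProd j (shift (gaussExp n j) h)))) t
        ≡⟨ respects (multiplier (gaussFactors-central n j)) moved t ⟩
      gaussFactors n j next t
        ≡⟨ prodBetween-lower minusEven j n j<n next t ⟩
      minusEven (suc j) (summand (suc j)) t ∎
      where open ≡-Reasoning

  summand′-telescopes : ∀ k → k ≤ n →
    summand′ k t ≡ (summand k t ℤ.+ shift (suc (n + n)) (summand k) t) ℤ.+ -1ℤ ℤ.* (boundary k ℤ.+ prev boundary k)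
  summand′-telescopes k k≤n = begin
    summand′ k t
      ≡⟨ prodBetween-upper minusEven-central k n k≤n (plusOddProd k (shift (gaussExp (suc n) k) h)) t ⟩
    minusEven (suc n) (gaussFactors n k (plusOddProd k (shift (gaussExp (suc n) k) h))) t
      ≡⟨ cong₂ (λ x y → x ℤ.+ -1ℤ ℤ.* y) (shifted-summand k t)
           (trans (shift-causal (suc n + suc n) t (λ s _ → shifted-summand k s))
                  (shift-shift (suc n + suc n) (k + k) (summand k) t)) ⟩
    shift (k + k) (summand k) t ℤ.+ -1ℤ ℤ.* shift (suc n + suc n + (k + k)) (summand k) t
      ≡⟨ cong₂ (λ x y → x ℤ.+ -1ℤ ℤ.* y) (boundary-prev k k≤n)
           (trans (cong (λ e → shift e (summand k) t) (exponent n k))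
                  (sym (shift-shift (suc (n + n)) (suc (k + k)) (summand k) t))) ⟩
    summand k t ℤ.+ -1ℤ ℤ.* prev boundary k ℤ.+ -1ℤ ℤ.* shift (suc (n + n)) (shift (suc (k + k)) (summand k)) t
      ≡⟨ regroup (summand k t) (prev boundary k) (shift (suc (n + n)) (summand k) t) _ ⟩
    (summand k t ℤ.+ c) ℤ.+ -1ℤ ℤ.* ((c ℤ.+ shift (suc (n + n)) (shift (suc (k + k)) (summand k)) t) ℤ.+ prev boundary k)
      ≡⟨ cong (λ x → (summand k t ℤ.+ c) ℤ.+ -1ℤ ℤ.* (x ℤ.+ prev boundary k))
              (sym (shift-⊕ (suc (n + n)) (summand k) (shift (suc (k + k)) (summand k)) t)) ⟩
    (summand k t ℤ.+ c) ℤ.+ -1ℤ ℤ.* (boundary k ℤ.+ prev boundary k) ∎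
    where
    open ≡-Reasoning
    c = shift (suc (n + n)) (summand k) t
    exponent : ∀ n k → suc n + suc n + (k + k) ≡ suc (n + n) + suc (k + k)
    exponent = ℕ-Ring.solve-∀
    regroup : ∀ a b c d → a ℤ.+ -1ℤ ℤ.* b ℤ.+ -1ℤ ℤ.* d ≡ (a ℤ.+ c) ℤ.+ -1ℤ ℤ.* ((c ℤ.+ d) ℤ.+ b)
    regroup = solve-∀

  last-boundary : boundary n ≡ plusOddProd (suc n) (shift (triOdd n) h) t
  last-boundary = begin
    boundary n
      ≡⟨ shift-causal (suc (n + n)) t (λ s _ →
           trans (cong₂ ℤ._+_ (prodBetween-empty minusEven n _ s)
                              (shift-causal (suc (n + n)) s (λ r _ → prodBetween-empty minusEven n _ r)))
                 (sym (plusOddProd-suc n (shift (gaussExp n n) h) s))) ⟩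
    shift (suc (n + n)) (plusOddProd (suc n) (shift (gaussExp n n) h)) t
      ≡⟨ shift-invariant (multiplier (plusOddProd-central (suc n))) (suc (n + n)) (shift (gaussExp n n) h) t ⟨
    plusOddProd (suc n) (shift (suc (n + n)) (shift (gaussExp n n) h)) t
      ≡⟨ respects (multiplier (plusOddProd-central (suc n))) (shift-shift (suc (n + n)) (gaussExp n n) h) t ⟩
    plusOddProd (suc n) (shift (triOdd n) h) t ∎
    where open ≡-Reasoning

  step : altSeries summand′ n t
       ≡ 1+x^ (suc (n + n)) (gaussSum n h) t ℤ.+ -1^ suc n ℤ.* plusOddProd (suc n) (shift (triOdd n) h) t
  step = begin
    altSeries summand′ n t
      ≡⟨ altSeries-coeff summand′ n t ⟩
    altSum (λ k → summand′ k t) n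
      ≡⟨ altSum-cong _ _ n summand′-telescopes ⟩
    altSum (λ k → (summand k t ℤ.+ shift (suc (n + n)) (summand k) t) ℤ.+ -1ℤ ℤ.* (boundary k ℤ.+ prev boundary k)) n
      ≡⟨ altSum-minus (λ k → summand k t ℤ.+ shift (suc (n + n)) (summand k) t) (λ k → boundary k ℤ.+ prev boundary k) n ⟩
    altSum (λ k → summand k t ℤ.+ shift (suc (n + n)) (summand k) t) n ℤ.+ -1ℤ ℤ.* altSum (λ k → boundary k ℤ.+ prev boundary k) n
      ≡⟨ cong₂ (λ x y → x ℤ.+ -1ℤ ℤ.* y) (altSum-+ (λ k → summand k t) (λ k → shift (suc (n + n)) (summand k) t) n)
                                          (altSum-telescope boundary n) ⟩
    altSum (λ k → summand k t) n ℤ.+ altSum (λ k → shift (suc (n + n)) (summand k) t) n ℤ.+ -1ℤ ℤ.* (-1^ n ℤ.* boundary n)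
      ≡⟨ cong₂ (λ x y → x ℤ.+ -1ℤ ℤ.* (-1^ n ℤ.* y))
           (cong₂ ℤ._+_ (sym (altSeries-coeff summand n t)) (sym (multiplier-altSeries (shift-multiplier (suc (n + n))) summand n t)))
           last-boundary ⟩
    gaussSum n h t ℤ.+ shift (suc (n + n)) (gaussSum n h) t ℤ.+ -1ℤ ℤ.* (-1^ n ℤ.* plusOddProd (suc n) (shift (triOdd n) h) t)
      ≡⟨ regroup (gaussSum n h t) (shift (suc (n + n)) (gaussSum n h) t) (-1^ n) _ ⟩
    1+x^ (suc (n + n)) (gaussSum n h) t ℤ.+ -1^ suc n ℤ.* plusOddProd (suc n) (shift (triOdd n) h) t ∎
    where
    open ≡-Reasoning
    regroup : ∀ a b s x → a ℤ.+ b ℤ.+ -1ℤ ℤ.* (s ℤ.* x) ≡ a ℤ.+ b ℤ.+ (ℤ.- s) ℤ.* x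
    regroup = solve-∀

gauss-identity : ∀ n h t → gaussSum n h t ≡ plusOddProd n (theta n h) t
gauss-identity zero    h t = refl
gauss-identity (suc n) h t = begin
  altSeries summand′ n t ℤ.+ s ℤ.* summand′ (suc n) t
    ≡⟨ cong (λ x → x ℤ.+ s ℤ.* summand′ (suc n) t) step ⟩
  1+x^ (suc (n + n)) (gaussSum n h) t ℤ.+ s ℤ.* B (shift (triOdd n) h) t ℤ.+ s ℤ.* summand′ (suc n) t
    ≡⟨ cong₂ (λ x y → x ℤ.+ s ℤ.* B (shift (triOdd n) h) t ℤ.+ s ℤ.* y) induction last-summand ⟩
  B (theta n h) t ℤ.+ s ℤ.* B (shift (triOdd n) h) t ℤ.+ s ℤ.* B (shift (triEven n) h) t
    ≡⟨ regroup (B (theta n h) t) s (B (shift (triOdd n) h) t) (B (shift (triEven n) h) t) ⟩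
  B (theta n h) t ℤ.+ s ℤ.* (B (shift (triOdd n) h) t ℤ.+ B (shift (triEven n) h) t)
    ≡⟨ cong (λ x → B (theta n h) t ℤ.+ s ℤ.* x) (additive mB _ _ t) ⟨
  B (theta n h) t ℤ.+ s ℤ.* B (shift (triOdd n) h ⊕ shift (triEven n) h) t
    ≡⟨ cong (λ x → B (theta n h) t ℤ.+ x) (homogeneous mB s _ t) ⟨
  B (theta n h) t ℤ.+ B (s ⊙ (shift (triOdd n) h ⊕ shift (triEven n) h)) t
    ≡⟨ additive mB (theta n h) _ t ⟨
  B (theta (suc n) h) t ∎
  where
  open GaussStep n h t
  open ≡-Reasoning
  s = -1^ suc n
  B = plusOddProd (suc n)
  mB = multiplier (plusOddProd-central (suc n))
  induction : 1+x^ (suc (n + n)) (gaussSum n h) t ≡ B (theta n h) t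
  induction = trans (respects (1+x^-multiplier (suc (n + n))) (gauss-identity n h) t)
                    (sym (plusOddProd-suc n (theta n h) t))
  last-summand : summand′ (suc n) t ≡ B (shift (triEven n) h) t
  last-summand = trans (prodBetween-empty minusEven (suc n) _ t)
                       (respects mB (λ r → cong (λ e → shift (suc n * suc (suc e)) h r) (ℕₚ.+-suc n n)) t)
  regroup : ∀ r s p q → r ℤ.+ s ℤ.* p ℤ.+ s ℤ.* q ≡ r ℤ.+ s ℤ.* (p ℤ.+ q)
  regroup = solve-∀

gaussSum≈gaussFactors : ∀ n h t → t ≤ n + n → gaussSum n h t ≡ gaussFactors n 0 h t
gaussSum≈gaussFactors n h t t≤2n = trans (altSeries-coeff _ n t) (altSum-head _ n vanish)
  where
  vanish : ∀ k → gaussFactors n (suc k) (plusOddProd (suc k) (shift (gaussExp n (suc k)) h)) t ≡ + 0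
  vanish k = trans (shift-invariant (gaussSummand-multiplier n (suc k)) (gaussExp n (suc k)) h t)
                   (shift-below _ _ t (s≤s (ℕₚ.≤-trans t≤2n (ℕₚ.m≤m+n (n + n) _))))

-- The product ∏ (1 - x^i) ∏ (1 + x^{2i}) agrees with Θ

minusOdd : ℕ → Op
minusOdd zero    = 1-x^ 0
minusOdd (suc i) = 1-x^ (suc (i + i))

minusOdd-central : ∀ i → IsCentral (minusOdd i)
minusOdd-central zero    = 1-x^-central 0
minusOdd-central (suc i) = 1-x^-central (suc (i + i))

minusOddProd : ℕ → Op
minusOddProd = prodAfter minusOdd 0

minusOddProd-central : ∀ n → IsCentral (minusOddProd n)
minusOddProd-central = prodAfter-central minusOdd-central 0

eulerProd-split : ∀ n f t → eulerProd (n + n) f t ≡ minusOddProd n (gaussFactors n 0 f) t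
eulerProd-split zero    f t = refl
eulerProd-split (suc n) f t = begin
  eulerProd (suc n + suc n) f t
    ≡⟨ cong (λ N → eulerProd N f t) (ℕₚ.+-suc (suc n) n) ⟩
  eulerProd (suc (suc (n + n))) f t
    ≡⟨ prodAfter-suc 1-x^-central 0 (suc (n + n)) f t ⟩
  1-x^ even (eulerProd (suc (n + n)) f) t
    ≡⟨ respects (1-x^-multiplier even) (λ s → trans (prodAfter-suc 1-x^-central 0 (n + n) f s)
                                                    (respects (1-x^-multiplier odd) (eulerProd-split n f) s)) t ⟩
  1-x^ even (1-x^ odd (O (A f))) t
    ≡⟨ commutes (1-x^-central odd) (1-x^-multiplier even) (O (A f)) t ⟨
  1-x^ odd (1-x^ even (O (A f))) t
    ≡⟨ respects (1-x^-multiplier odd) (commutes (minusOddProd-central n) (1-x^-multiplier even) (A f)) t ⟨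
  1-x^ odd (O (1-x^ even (A f))) t
    ≡⟨ respects (1-x^-multiplier odd) (λ s → cong (λ a → O (1-x^ a (A f)) s) (sym (ℕₚ.+-suc (suc n) n))) t ⟩
  1-x^ odd (O (minusEven (suc n) (A f))) t
    ≡⟨ respects (1-x^-multiplier odd)
         (respects (multiplier (minusOddProd-central n)) (prodBetween-upper minusEven-central 0 n z≤n f)) t ⟨
  1-x^ odd (O (gaussFactors (suc n) 0 f)) t
    ≡⟨ prodAfter-suc minusOdd-central 0 n (gaussFactors (suc n) 0 f) t ⟨
  minusOddProd (suc n) (gaussFactors (suc n) 0 f) t ∎
  where
  open ≡-Reasoning
  odd even : ℕ
  odd  = suc (n + n)
  even = suc (suc (n + n))
  O = minusOddProd n
  A = gaussFactors n 0

1+x^∘1-x^ : ∀ a f t → 1+x^ a (1-x^ a f) t ≡ 1-x^ (a + a) f t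
1+x^∘1-x^ a f t = begin
  f t ℤ.+ -1ℤ ℤ.* shift a f t ℤ.+ shift a (f ⊕ -1ℤ ⊙ shift a f) t
    ≡⟨ cong (λ x → f t ℤ.+ -1ℤ ℤ.* shift a f t ℤ.+ x)
            (trans (shift-⊕ a f _ t) (cong (λ x → shift a f t ℤ.+ x) (shift-⊙ a -1ℤ (shift a f) t))) ⟩
  f t ℤ.+ -1ℤ ℤ.* shift a f t ℤ.+ (shift a f t ℤ.+ -1ℤ ℤ.* shift a (shift a f) t)
    ≡⟨ cancel (f t) (shift a f t) (shift a (shift a f) t) ⟩
  f t ℤ.+ -1ℤ ℤ.* shift a (shift a f) t
    ≡⟨ cong (λ x → f t ℤ.+ -1ℤ ℤ.* x) (shift-shift a a f t) ⟩
  f t ℤ.+ -1ℤ ℤ.* shift (a + a) f t ∎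
  where
  open ≡-Reasoning
  cancel : ∀ x y z → x ℤ.+ -1ℤ ℤ.* y ℤ.+ (y ℤ.+ -1ℤ ℤ.* z) ≡ x ℤ.+ -1ℤ ℤ.* z
  cancel = solve-∀

minusTwiceOdd : ℕ → Op
minusTwiceOdd zero    = 1-x^ 0
minusTwiceOdd (suc i) = 1-x^ (suc (i + i) + suc (i + i))

minusTwiceOdd-central : ∀ i → IsCentral (minusTwiceOdd i)
minusTwiceOdd-central zero    = 1-x^-central 0
minusTwiceOdd-central (suc i) = 1-x^-central (suc (i + i) + suc (i + i))

minusTwiceOddProd : ℕ → Op
minusTwiceOddProd = prodAfter minusTwiceOdd 0

plusOddProd∘minusOddProd : ∀ n f t → plusOddProd n (minusOddProd n f) t ≡ minusTwiceOddProd n f t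
plusOddProd∘minusOddProd zero    f t = refl
plusOddProd∘minusOddProd (suc n) f t = begin
  plusOddProd (suc n) (minusOddProd (suc n) f) t
    ≡⟨ plusOddProd-suc n (minusOddProd (suc n) f) t ⟩
  1+x^ odd (plusOddProd n (minusOddProd (suc n) f)) t
    ≡⟨ respects (1+x^-multiplier odd)
         (λ s → trans (respects (multiplier (plusOddProd-central n)) (prodAfter-suc minusOdd-central 0 n f) s)
                      (commutes (plusOddProd-central n) (1-x^-multiplier odd) (minusOddProd n f) s)) t ⟩
  1+x^ odd (1-x^ odd (plusOddProd n (minusOddProd n f))) t
    ≡⟨ 1+x^∘1-x^ odd (plusOddProd n (minusOddProd n f)) t ⟩
  1-x^ (odd + odd) (plusOddProd n (minusOddProd n f)) t
    ≡⟨ respects (1-x^-multiplier (odd + odd)) (plusOddProd∘minusOddProd n f) t ⟩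
  1-x^ (odd + odd) (minusTwiceOddProd n f) t
    ≡⟨ prodAfter-suc minusTwiceOdd-central 0 n f t ⟨
  minusTwiceOddProd (suc n) f t ∎
  where
  open ≡-Reasoning
  odd = suc (n + n)

plusEven : ℕ → Op
plusEven i = 1+x^ (i + i)

plusEvenProd : ℕ → Op
plusEvenProd = prodAfter plusEven 0

plusEvenProd-suc : ∀ n f t → plusEvenProd (suc n) f t ≡ 1+x^ (suc n + suc n) (plusEvenProd n f) t
plusEvenProd-suc = prodAfter-suc (λ i → 1+x^-central (i + i)) 0

minusEvenBlock : ℕ → Op
minusEvenBlock n = prodAfter minusEven n n

minusEvenBlock-central : ∀ n → IsCentral (minusEvenBlock n)
minusEvenBlock-central n = prodAfter-central minusEven-central n n

minusEvenBlock-suc : ∀ n f t → minusTwiceOdd (suc n) (plusEven (suc n) (minusEvenBlock n f)) t ≡ minusEvenBlock (suc n) f t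
minusEvenBlock-suc zero    f t = trans (commutes (1-x^-central 2) (1+x^-multiplier 2) f t) (1+x^∘1-x^ 2 f t)
minusEvenBlock-suc (suc m) f t = begin
  1-x^ a₃ (1+x^ a₂ (1-x^ a₂ (R f))) t
    ≡⟨ respects (1-x^-multiplier a₃) (1+x^∘1-x^ a₂ (R f)) t ⟩
  1-x^ a₃ (1-x^ (a₂ + a₂) (R f)) t
    ≡⟨ commutes (1-x^-central a₃) (1-x^-multiplier (a₂ + a₂)) (R f) t ⟩
  1-x^ (a₂ + a₂) (1-x^ a₃ (R f)) t
    ≡⟨ cong₂ (λ a b → 1-x^ a (1-x^ b (R f)) t) (exponent-top m) (exponent-mid m) ⟩
  minusEven (suc (suc (suc m) + suc m)) (minusEven (suc (suc (suc m) + m)) (R f)) t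
    ≡⟨ trans (prodAfter-suc minusEven-central (suc (suc m)) (suc m) f t)
             (respects (1-x^-multiplier (suc (suc (suc m) + suc m) + suc (suc (suc m) + suc m)))
                      (prodAfter-suc minusEven-central (suc (suc m)) m f) t) ⟨
  minusEvenBlock (suc (suc m)) f t ∎
  where
  open ≡-Reasoning
  a₂ = suc (suc m) + suc (suc m)
  a₃ = suc (suc m + suc m) + suc (suc m + suc m)
  R = prodAfter minusEven (suc (suc m)) m
  exponent-top : ∀ m → suc (suc m) + suc (suc m) + (suc (suc m) + suc (suc m))
                     ≡ suc (suc (suc m) + suc m) + suc (suc (suc m) + suc m)
  exponent-top = ℕ-Ring.solve-∀
  exponent-mid : ∀ m → suc (suc m + suc m) + suc (suc m + suc m) ≡ suc (suc (suc m) + m) + suc (suc (suc m) + m)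
  exponent-mid = ℕ-Ring.solve-∀

minusTwiceOddProd∘plusEvenProd : ∀ n f t → minusTwiceOddProd n (plusEvenProd n f) t ≡ minusEvenBlock n f t
minusTwiceOddProd∘plusEvenProd zero    f t = refl
minusTwiceOddProd∘plusEvenProd (suc n) f t = begin
  minusTwiceOddProd (suc n) (plusEvenProd (suc n) f) t
    ≡⟨ prodAfter-suc minusTwiceOdd-central 0 n _ t ⟩
  minusTwiceOdd (suc n) (W (plusEvenProd (suc n) f)) t
    ≡⟨ respects (1-x^-multiplier twiceOdd)
         (λ s → trans (respects (multiplier cW) (plusEvenProd-suc n f) s)
                      (commutes cW (1+x^-multiplier (suc n + suc n)) (plusEvenProd n f) s)) t ⟩
  minusTwiceOdd (suc n) (plusEven (suc n) (W (plusEvenProd n f))) t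
    ≡⟨ respects (1-x^-multiplier twiceOdd) (respects (1+x^-multiplier (suc n + suc n)) (minusTwiceOddProd∘plusEvenProd n f)) t ⟩
  minusTwiceOdd (suc n) (plusEven (suc n) (minusEvenBlock n f)) t
    ≡⟨ minusEvenBlock-suc n f t ⟩
  minusEvenBlock (suc n) f t ∎
  where
  open ≡-Reasoning
  twiceOdd = suc (n + n) + suc (n + n)
  W = minusTwiceOddProd n
  cW = prodAfter-central minusTwiceOdd-central 0 n

minusEven-prodAfter-low : ∀ k l f t → t < suc k + suc k → prodAfter minusEven k l f t ≡ f t
minusEven-prodAfter-low k zero    f t _   = refl
minusEven-prodAfter-low k (suc l) f t t<2k+2 = begin
  prodAfter minusEven (suc k) l f t ℤ.+ -1ℤ ℤ.* shift (suc k + suc k) (prodAfter minusEven (suc k) l f) t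
    ≡⟨ cong₂ (λ x y → x ℤ.+ -1ℤ ℤ.* y)
             (minusEven-prodAfter-low (suc k) l f t (ℕₚ.<-≤-trans t<2k+2 (ℕₚ.+-mono-≤ (ℕₚ.n≤1+n (suc k)) (ℕₚ.n≤1+n (suc k)))))
             (shift-below _ _ t t<2k+2) ⟩
  f t ℤ.+ -1ℤ ℤ.* + 0
    ≡⟨ trans (cong (λ x → f t ℤ.+ x) (ℤₚ.*-zeroʳ -1ℤ)) (ℤₚ.+-identityʳ (f t)) ⟩
  f t ∎
  where open ≡-Reasoning

eulerProd∘plusEvenProd≈theta : ∀ M h t → t ≤ M + M → eulerProd (M + M) (plusEvenProd M h) t ≡ theta M h t
eulerProd∘plusEvenProd≈theta M h t t≤2M = begin
  eulerProd (M + M) g t                   ≡⟨ eulerProd-split M g t ⟩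
  O (A g) t                               ≡⟨ commutes cO (multiplier (gaussFactors-central M 0)) g t ⟩
  A (O g) t                               ≡⟨ gaussSum≈gaussFactors M (O g) t t≤2M ⟨
  gaussSum M (O g) t                      ≡⟨ gauss-identity M (O g) t ⟩
  B (theta M (O g)) t                     ≡⟨ commutes cB (theta-multiplier M) (O g) t ⟩
  theta M (B (O g)) t                     ≡⟨ respects (theta-multiplier M) (λ s → plusOddProd∘minusOddProd M g s) t ⟩
  theta M (minusTwiceOddProd M g) t       ≡⟨ respects (theta-multiplier M) (minusTwiceOddProd∘plusEvenProd M h) t ⟩
  theta M (minusEvenBlock M h) t          ≡⟨ commutes (minusEvenBlock-central M) (theta-multiplier M) h t ⟨
  minusEvenBlock M (theta M h) t          ≡⟨ minusEven-prodAfter-low M M (theta M h) t (s≤s (ℕₚ.≤-trans t≤2M (ℕₚ.+-monoʳ-≤ M (ℕₚ.n≤1+n M)))) ⟩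
  theta M h t                             ∎
  where
  open ≡-Reasoning
  g = plusEvenProd M h
  O = minusOddProd M
  A = gaussFactors M 0
  B = plusOddProd M
  cO = minusOddProd-central M
  cB = plusOddProd-central M

-- Distinct partitions

even-or-odd : ∀ d → ∃ λ y → d ≡ y + y ⊎ d ≡ suc (y + y)
even-or-odd zero    = 0 , inj₁ refl
even-or-odd (suc d) with even-or-odd d
... | y , inj₁ refl = y , inj₂ refl
... | y , inj₂ refl = suc y , inj₁ (cong suc (sym (ℕₚ.+-suc y y)))

y+y≡2*y : ∀ y → y + y ≡ 2 * y
y+y≡2*y y = cong (λ z → y + z) (sym (ℕₚ.+-identityʳ y))

countDistinct : ℕ → ℕ → ℕ
countDistinct y M = length (dparts y M)

countDistinct-fits : ∀ y M → suc M ≤ y → countDistinct y (suc M) ≡ countDistinct y M + countDistinct (y ∸ suc M) M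
countDistinct-fits (suc y) M M<y with suc M ℕₚ.≤? suc y
... | yes _   = trans (Listₚ.length-++ (dparts (suc y) M))
                      (cong (λ c → countDistinct (suc y) M + c) (Listₚ.length-map (suc M ∷_) (dparts (y ∸ M) M)))
... | no  M≮y = ⊥-elim (M≮y M<y)

countDistinct-too-big : ∀ y M → y < suc M → countDistinct y (suc M) ≡ countDistinct y M
countDistinct-too-big zero    M _ = refl
countDistinct-too-big (suc y) M (s≤s y<M) with suc M ℕₚ.≤? suc y
... | yes (s≤s M≤y) = ⊥-elim (ℕₚ.<⇒≱ y<M M≤y)
... | no  _         = refl

countDistinct≡q : ∀ y M → y ≤ M → countDistinct y M ≡ q y
countDistinct≡q y zero    y≤0   rewrite ℕₚ.n≤0⇒n≡0 y≤0 = refl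
countDistinct≡q y (suc M) y≤1+M with ℕₚ.m≤n⇒m<n∨m≡n y≤1+M
... | inj₁ y<1+M = trans (countDistinct-too-big y M y<1+M) (countDistinct≡q y M (ℕₚ.≤-pred y<1+M))
... | inj₂ refl  = refl

∸-double : ∀ y M → (y + y) ∸ (M + M) ≡ (y ∸ M) + (y ∸ M)
∸-double y       zero    = refl
∸-double zero    (suc M) = refl
∸-double (suc y) (suc M) = trans (cong₂ _∸_ (ℕₚ.+-suc y y) (ℕₚ.+-suc M M)) (∸-double y M)

plusEvenProd-even : ∀ M y → plusEvenProd M one (y + y) ≡ + countDistinct y M
plusEvenProd-even zero    zero    = refl
plusEvenProd-even zero    (suc y) = refl
plusEvenProd-even (suc M) y with suc M ℕₚ.≤? y
... | yes M<y = begin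
  plusEvenProd (suc M) one (y + y)
    ≡⟨ plusEvenProd-suc M one (y + y) ⟩
  P (y + y) ℤ.+ shift (suc M + suc M) P (y + y)
    ≡⟨ cong (λ x → P (y + y) ℤ.+ x) (shift-above _ P _ (ℕₚ.+-mono-≤ M<y M<y)) ⟩
  P (y + y) ℤ.+ P ((y + y) ∸ (suc M + suc M))
    ≡⟨ cong₂ ℤ._+_ (plusEvenProd-even M y)
                   (trans (cong P (∸-double y (suc M))) (plusEvenProd-even M (y ∸ suc M))) ⟩
  + (countDistinct y M + countDistinct (y ∸ suc M) M)
    ≡⟨ cong +_ (countDistinct-fits y M M<y) ⟨
  + countDistinct y (suc M) ∎
  where
  open ≡-Reasoning
  P = plusEvenProd M one
... | no M≮y = begin
  plusEvenProd (suc M) one (y + y)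
    ≡⟨ plusEvenProd-suc M one (y + y) ⟩
  P (y + y) ℤ.+ shift (suc M + suc M) P (y + y)
    ≡⟨ cong₂ ℤ._+_ (plusEvenProd-even M y) (shift-below _ P _ (ℕₚ.+-mono-< y<1+M y<1+M)) ⟩
  + (countDistinct y M + 0)
    ≡⟨ cong +_ (trans (ℕₚ.+-identityʳ _) (sym (countDistinct-too-big y M y<1+M))) ⟩
  + countDistinct y (suc M) ∎
  where
  open ≡-Reasoning
  P = plusEvenProd M one
  y<1+M = ℕₚ.≰⇒> M≮y

plusEvenProd-odd : ∀ M y → plusEvenProd M one (suc (y + y)) ≡ + 0
plusEvenProd-odd zero    y = refl
plusEvenProd-odd (suc M) y with suc M ℕₚ.≤? y
... | yes M<y = trans (plusEvenProd-suc M one (suc (y + y)))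
                      (cong₂ ℤ._+_ (plusEvenProd-odd M y) (begin
  shift (suc M + suc M) P (suc (y + y))
    ≡⟨ shift-above _ P _ (ℕₚ.m≤n⇒m≤1+n (ℕₚ.+-mono-≤ M<y M<y)) ⟩
  P (suc (y + y) ∸ (suc M + suc M))
    ≡⟨ cong P (trans (ℕₚ.+-∸-assoc 1 (ℕₚ.+-mono-≤ M<y M<y)) (cong suc (∸-double y (suc M)))) ⟩
  P (suc ((y ∸ suc M) + (y ∸ suc M)))
    ≡⟨ plusEvenProd-odd M (y ∸ suc M) ⟩
  + 0 ∎))
  where
  open ≡-Reasoning
  P = plusEvenProd M one
... | no M≮y = trans (plusEvenProd-suc M one (suc (y + y)))
                     (cong₂ ℤ._+_ (plusEvenProd-odd M y) (shift-below _ _ _ odd<2M+2))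
  where
  y≤M = ℕₚ.≤-pred (ℕₚ.≰⇒> M≮y)
  odd<2M+2 : suc (y + y) < suc M + suc M
  odd<2M+2 = s≤s (subst (y + y <_) (sym (ℕₚ.+-suc M M)) (s≤s (ℕₚ.+-mono-≤ y≤M y≤M)))

gcd[2y,2]≡2 : ∀ y → gcd (y + y) 2 ≡ 2
gcd[2y,2]≡2 y = begin
  gcd (y + y) 2       ≡⟨ cong (λ m → gcd m 2) (y+y≡2*y y) ⟩
  gcd (2 * y) (2 * 1) ≡⟨ c*gcd[m,n]≡gcd[cm,cn] 2 y 1 ⟨
  2 * gcd y 1         ≡⟨ cong (2 *_) (gcd-zeroʳ y) ⟩
  2                   ∎
  where open ≡-Reasoning

odd-coprime-2 : ∀ y → Coprime (suc (y + y)) 2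
odd-coprime-2 zero    = 1-coprimeTo 2
odd-coprime-2 (suc y) = subst (λ m → Coprime m 2) (cong (suc ∘ suc) (sym (ℕₚ.+-suc y y))) (coprime-+ (odd-coprime-2 y))

qℚ-integer : ∀ p y → ↥ p ≡ + y → ↧ p ≡ + 1 → qℚ p ≡ q y
qℚ-integer (mkℚ (+ a)    zero    _) y refl refl = refl
qℚ-integer (mkℚ (+ a)    (suc d) _) y _    ()
qℚ-integer (mkℚ -[1+ a ] d       _) y ()   _

qℚ-/2-even : ∀ y → qℚ ((+ (y + y)) ℚ./ 2) ≡ q y
qℚ-/2-even y = qℚ-integer p y (cancel-2 (↥ p) (+ y) num·2) (cancel-2 (↧ p) (+ 1) den·2)
  where
  p = (+ (y + y)) ℚ./ 2
  cancel-2 : ∀ i j → i ℤ.* + 2 ≡ j ℤ.* + 2 → i ≡ j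
  cancel-2 i j = ℤₚ.*-cancelʳ-≡ i j (+ 2)
  num·2 : ↥ p ℤ.* + 2 ≡ + y ℤ.* + 2
  num·2 = trans (cong (λ g → ↥ p ℤ.* + g) (sym (gcd[2y,2]≡2 y)))
                (trans (ℚₚ.↥-/ (+ (y + y)) 2) (trans (cong +_ (trans (y+y≡2*y y) (ℕₚ.*-comm 2 y))) (ℤₚ.pos-* y 2)))
  den·2 : ↧ p ℤ.* + 2 ≡ + 1 ℤ.* + 2
  den·2 = trans (cong (λ g → ↧ p ℤ.* + g) (sym (gcd[2y,2]≡2 y))) (ℚₚ.↧-/ (+ (y + y)) 2)

qℚ-/2-odd : ∀ y → qℚ ((+ suc (y + y)) ℚ./ 2) ≡ 0
qℚ-/2-odd y = not-integer p den≡2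
  where
  p = (+ suc (y + y)) ℚ./ 2
  not-integer : ∀ p → ↧ p ≡ + 2 → qℚ p ≡ 0
  not-integer (mkℚ (+ a)    (suc d) _) _ = refl
  not-integer (mkℚ -[1+ a ] d       _) _ = refl
  den≡2 : ↧ p ≡ + 2
  den≡2 = trans (sym (ℤₚ.*-identityʳ (↧ p)))
                (trans (cong (λ g → ↧ p ℤ.* + g) (sym (coprime⇒gcd≡1 (odd-coprime-2 y)))) (ℚₚ.↧-/ (+ suc (y + y)) 2))

qℚ-/2-negative : ∀ m → 0 < m → qℚ ((ℤ.- (+ m)) ℚ./ 2) ≡ 0
qℚ-/2-negative (suc k) _ =
  negative p (λ a ↥p≡a → positive≢negative {a} (trans (sym (cong (ℤ._* + g) ↥p≡a)) (ℚₚ.↥-/ -[1+ k ] 2)))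
  where
  p = -[1+ k ] ℚ./ 2
  g = gcd (suc k) 2
  negative : ∀ p → (∀ a → ↥ p ≢ + a) → qℚ p ≡ 0
  negative (mkℚ (+ a)    d _) ↥p≢a = ⊥-elim (↥p≢a a refl)
  negative (mkℚ -[1+ a ] d _) _    = refl
  positive≢negative : ∀ {a} → + a ℤ.* + g ≢ -[1+ k ]
  positive≢negative {a} eq with trans (ℤₚ.pos-* a g) eq
  ... | ()

plusEvenProd-coeff : ∀ M d → d ≤ M + M → plusEvenProd M one d ≡ + qℚ ((+ d) ℚ./ 2)
plusEvenProd-coeff M d d≤2M with even-or-odd d
... | y , inj₁ refl = trans (plusEvenProd-even M y)
                            (cong +_ (trans (countDistinct≡q y M y≤M) (sym (qℚ-/2-even y))))
  where
  y≤M : y ≤ M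
  y≤M with y ℕₚ.≤? M
  ... | yes y≤M = y≤M
  ... | no  y≰M = ⊥-elim (ℕₚ.<⇒≱ (ℕₚ.+-mono-< (ℕₚ.≰⇒> y≰M) (ℕₚ.≰⇒> y≰M)) d≤2M)
... | y , inj₂ refl = trans (plusEvenProd-odd M y) (cong +_ (sym (qℚ-/2-odd y)))

shift-plusEvenProd : ∀ M n e → n ≤ M → shift e (plusEvenProd M one) (2 * n) ≡ + qℚ (half n e)
shift-plusEvenProd M n e n≤M with e ℕₚ.≤? 2 * n
... | yes e≤2n = begin
  shift e (plusEvenProd M one) (2 * n)    ≡⟨ shift-above e _ _ e≤2n ⟩
  plusEvenProd M one (2 * n ∸ e)          ≡⟨ plusEvenProd-coeff M _ (ℕₚ.≤-trans (ℕₚ.m∸n≤m (2 * n) e) 2n≤2M) ⟩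
  + qℚ ((+ (2 * n ∸ e)) ℚ./ 2)            ≡⟨ cong (λ i → + qℚ (i ℚ./ 2)) (sym (trans numerator (ℤₚ.⊖-≥ e≤2n))) ⟩
  + qℚ (half n e)                         ∎
  where
  open ≡-Reasoning
  numerator = ℤₚ.[+m]-[+n]≡m⊖n (2 * n) e
  2n≤2M = subst (_≤ M + M) (y+y≡2*y n) (ℕₚ.+-mono-≤ n≤M n≤M)
... | no e≰2n = begin
  shift e (plusEvenProd M one) (2 * n)    ≡⟨ shift-below e _ _ 2n<e ⟩
  + 0                                     ≡⟨ cong +_ (qℚ-/2-negative (e ∸ 2 * n) (ℕₚ.m<n⇒0<n∸m 2n<e)) ⟨
  + qℚ ((ℤ.- (+ (e ∸ 2 * n))) ℚ./ 2)      ≡⟨ cong (λ i → + qℚ (i ℚ./ 2)) (sym negative-numerator) ⟩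
  + qℚ (half n e)                         ∎
  where
  open ≡-Reasoning
  2n<e = ℕₚ.≰⇒> e≰2n
  negative-numerator : (+ (2 * n)) ℤ.- (+ e) ≡ ℤ.- (+ (e ∸ 2 * n))
  negative-numerator = trans (ℤₚ.[+m]-[+n]≡m⊖n (2 * n) e) (ℤₚ.⊖-< 2n<e)

-- The series of the theorem

tri*2 : ∀ k → tri k * 2 ≡ k * suc k
tri*2 zero    = refl
tri*2 (suc k) = begin
  (suc k + tri k) * 2        ≡⟨ ℕₚ.*-distribʳ-+ 2 (suc k) (tri k) ⟩
  suc k * 2 + tri k * 2      ≡⟨ cong (λ x → suc k * 2 + x) (tri*2 k) ⟩
  suc k * 2 + k * suc k      ≡⟨ expand k ⟩
  suc k * suc (suc k)        ∎
  where
  open ≡-Reasoning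
  expand : ∀ k → suc k * 2 + k * suc k ≡ suc k * suc (suc k)
  expand = ℕ-Ring.solve-∀

Q5≡pentQ : ∀ k → Q5 k ≡ pentQ k
Q5≡pentQ k = trans (cong (_/ 2) (sym doubled)) (m*n/n≡m (pentQ k) 2)
  where
  open ≡-Reasoning
  expand : ∀ k → k * k * 2 + k * suc k ≡ k * (3 * k + 1)
  expand = ℕ-Ring.solve-∀
  doubled : pentQ k * 2 ≡ k * (3 * k + 1)
  doubled = begin
    (k * k + tri k) * 2        ≡⟨ ℕₚ.*-distribʳ-+ 2 (k * k) (tri k) ⟩
    k * k * 2 + tri k * 2      ≡⟨ cong (λ x → k * k * 2 + x) (tri*2 k) ⟩
    k * k * 2 + k * suc k      ≡⟨ expand k ⟩
    k * (3 * k + 1)            ∎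

P5≡pentP : ∀ m → P5 (suc m) ≡ pentP (suc m)
P5≡pentP m = trans (cong (_/ 2) (sym doubled)) (m*n/n≡m (pentP (suc m)) 2)
  where
  open ≡-Reasoning
  a = suc (m + m) + m * m
  split : ∀ m x → (suc (m + m) + (m * m + x)) * 2 ≡ (suc (m + m) + m * m) * 2 + x * 2
  split = ℕ-Ring.solve-∀
  expand : ∀ m → (suc (m + m) + m * m) * 2 + m * suc m ≡ suc m * (m + 2 * suc m)
  expand = ℕ-Ring.solve-∀
  doubled : pentP (suc m) * 2 ≡ suc m * (3 * suc m ∸ 1)
  doubled = begin
    (suc (m + m) + (m * m + tri m)) * 2  ≡⟨ split m (tri m) ⟩
    a * 2 + tri m * 2                    ≡⟨ cong (λ x → a * 2 + x) (tri*2 m) ⟩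
    a * 2 + m * suc m                    ≡⟨ expand m ⟩
    suc m * (3 * suc m ∸ 1)              ∎

sgn≡-[-1^] : ∀ k → sgn k ≡ ℤ.- (-1^ k)
sgn≡-[-1^] zero          = refl
sgn≡-[-1^] (suc zero)    = refl
sgn≡-[-1^] (suc (suc k)) = trans (sgn≡-[-1^] k) (cong ℤ.-_ (sym (ℤₚ.neg-involutive (-1^ k))))

pentagonalSum-coeff : ∀ M n N → n ≤ M → pentagonalSum N (plusEvenProd M one) (2 * n) ≡ + q n ℤ.- partialSum n N
pentagonalSum-coeff M n zero    n≤M = begin
  plusEvenProd M one (2 * n)    ≡⟨ cong (plusEvenProd M one) (y+y≡2*y n) ⟨
  plusEvenProd M one (n + n)    ≡⟨ plusEvenProd-even M n ⟩
  + countDistinct n M           ≡⟨ cong +_ (countDistinct≡q n M n≤M) ⟩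
  + q n                         ≡⟨ ℤₚ.+-identityʳ (+ q n) ⟨
  + q n ℤ.- + 0                 ∎
  where open ≡-Reasoning
pentagonalSum-coeff M n (suc N) n≤M = begin
  pentagonalSum N g (2 * n) ℤ.+ -1^ suc N ℤ.* (shift (pentQ (suc N)) g (2 * n) ℤ.+ shift (pentP (suc N)) g (2 * n))
    ≡⟨ cong₂ (λ x y → x ℤ.+ -1^ suc N ℤ.* y) (pentagonalSum-coeff M n N n≤M)
             (cong₂ ℤ._+_ (trans (shift-plusEvenProd M n (pentQ (suc N)) n≤M) (cong (λ e → + qℚ (half n e)) (sym (Q5≡pentQ (suc N)))))
                          (trans (shift-plusEvenProd M n (pentP (suc N)) n≤M) (cong (λ e → + qℚ (half n e)) (sym (P5≡pentP N))))) ⟩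
  + q n ℤ.- partialSum n N ℤ.+ -1^ suc N ℤ.* (Q ℤ.+ P)
    ≡⟨ regroup (+ q n) (partialSum n N) (-1^ suc N) Q P ⟩
  + q n ℤ.- (partialSum n N ℤ.+ (ℤ.- (-1^ suc N)) ℤ.* (P ℤ.+ Q))
    ≡⟨ cong (λ s → + q n ℤ.- (partialSum n N ℤ.+ s ℤ.* (P ℤ.+ Q))) (sym (sgn≡-[-1^] (suc N))) ⟩
  + q n ℤ.- partialSum n (suc N) ∎
  where
  open ≡-Reasoning
  g = plusEvenProd M one
  P = + qℚ (half n (P5 (suc N)))
  Q = + qℚ (half n (Q5 (suc N)))
  regroup : ∀ a b s x y → a ℤ.- b ℤ.+ s ℤ.* (x ℤ.+ y) ≡ a ℤ.- (b ℤ.+ (ℤ.- s) ℤ.* (y ℤ.+ x))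
  regroup = solve-∀

-- Coefficients of Θ

triOdd<triEven : ∀ j → triOdd j < triEven j
triOdd<triEven j = subst (triOdd j <_) (sym (gap j)) (ℕₚ.m<m+n (triOdd j) (s≤s z≤n))
  where
  gap : ∀ j → suc j * suc (suc (suc (j + j))) ≡ suc j * suc (j + j) + (suc j + suc j)
  gap = ℕ-Ring.solve-∀

triEven<triOdd-suc : ∀ j → triEven j < triOdd (suc j)
triEven<triOdd-suc j = subst (triEven j <_) (sym (gap j)) (ℕₚ.m<m+n (triEven j) (s≤s z≤n))
  where
  gap : ∀ j → suc (suc j) * suc (suc j + suc j) ≡ suc j * suc (suc (suc (j + j))) + suc (suc (suc (j + j)))
  gap = ℕ-Ring.solve-∀

triEven<triOdd : ∀ {i j} → i < j → triEven i < triOdd j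
triEven<triOdd {i} {suc j} (s≤s i≤j) with ℕₚ.m≤n⇒m<n∨m≡n i≤j
... | inj₁ i<j = ℕₚ.<-trans (triEven<triOdd i<j) (ℕₚ.<-trans (triOdd<triEven j) (triEven<triOdd-suc j))
... | inj₂ refl = triEven<triOdd-suc i

Misses : ℕ → ℕ → Set
Misses t i = t ≢ triOdd i × t ≢ triEven i

theta-misses : ∀ a l t → (∀ i → a ≤ i → i < a + l → Misses t i) → theta (a + l) one t ≡ theta a one t
theta-misses a zero    t _      = cong (λ m → theta m one t) (ℕₚ.+-identityʳ a)
theta-misses a (suc l) t misses = begin
  theta (a + suc l) one t
    ≡⟨ cong (λ m → theta m one t) (ℕₚ.+-suc a l) ⟩
  theta (a + l) one t ℤ.+ s ℤ.* (shift (triOdd (a + l)) one t ℤ.+ shift (triEven (a + l)) one t)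
    ≡⟨ cong₂ (λ x y → x ℤ.+ s ℤ.* y)
             (theta-misses a l t (λ i a≤i i<a+l → misses i a≤i (ℕₚ.<-trans i<a+l a+l<a+1+l)))
             (cong₂ ℤ._+_ (shift-one-≢ _ t (proj₁ miss)) (shift-one-≢ _ t (proj₂ miss))) ⟩
  theta a one t ℤ.+ s ℤ.* + 0
    ≡⟨ trans (cong (λ x → theta a one t ℤ.+ x) (ℤₚ.*-zeroʳ s)) (ℤₚ.+-identityʳ _) ⟩
  theta a one t ∎
  where
  open ≡-Reasoning
  s = -1^ suc (a + l)
  a+l<a+1+l : a + l < a + suc l
  a+l<a+1+l = subst (a + l <_) (sym (ℕₚ.+-suc a l)) (ℕₚ.n<1+n (a + l))
  miss : Misses t (a + l)
  miss = misses (a + l) (ℕₚ.m≤m+n a l) a+l<a+1+l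

theta-hit : ∀ M j t → j < M → t ≡ triOdd j ⊎ t ≡ triEven j → theta M one t ≡ -1^ suc j
theta-hit M j t j<M hit = begin
  theta M one t
    ≡⟨ cong (λ m → theta m one t) (ℕₚ.m+[n∸m]≡n j<M) ⟨
  theta (suc j + (M ∸ suc j)) one t
    ≡⟨ theta-misses (suc j) (M ∸ suc j) t (λ i j<i _ → misses-above i j<i) ⟩
  theta (0 + j) one t ℤ.+ -1^ suc j ℤ.* (shift (triOdd j) one t ℤ.+ shift (triEven j) one t)
    ≡⟨ cong₂ (λ x y → x ℤ.+ -1^ suc j ℤ.* y) (theta-misses 0 j t (λ i _ i<j → misses-below i i<j)) exactly-one ⟩
  one t ℤ.+ -1^ suc j ℤ.* + 1
    ≡⟨ cong (λ x → x ℤ.+ -1^ suc j ℤ.* + 1) one-t≡0 ⟩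
  + 0 ℤ.+ -1^ suc j ℤ.* + 1
    ≡⟨ trans (ℤₚ.+-identityˡ _) (ℤₚ.*-identityʳ (-1^ suc j)) ⟩
  -1^ suc j ∎
  where
  open ≡-Reasoning
  lower : triOdd j ≤ t
  lower = [ ℕₚ.≤-reflexive ∘ sym , (λ t≡ → subst (triOdd j ≤_) (sym t≡) (ℕₚ.<⇒≤ (triOdd<triEven j))) ]′ hit
  upper : t ≤ triEven j
  upper = [ (λ t≡ → subst (_≤ triEven j) (sym t≡) (ℕₚ.<⇒≤ (triOdd<triEven j))) , ℕₚ.≤-reflexive ]′ hit
  misses-below : ∀ i → i < j → Misses t i
  misses-below i i<j = ℕₚ.>⇒≢ (ℕₚ.<-≤-trans (ℕₚ.<-trans (triOdd<triEven i) (triEven<triOdd i<j)) lower)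
                     , ℕₚ.>⇒≢ (ℕₚ.<-≤-trans (triEven<triOdd i<j) lower)
  misses-above : ∀ i → j < i → Misses t i
  misses-above i j<i = ℕₚ.<⇒≢ (ℕₚ.≤-<-trans upper (triEven<triOdd j<i))
                     , ℕₚ.<⇒≢ (ℕₚ.≤-<-trans upper (ℕₚ.<-trans (triEven<triOdd j<i) (triOdd<triEven i)))
  exactly-one : shift (triOdd j) one t ℤ.+ shift (triEven j) one t ≡ + 1
  exactly-one = [ (λ t≡ → cong₂ ℤ._+_ (subst (λ s → shift (triOdd j) one s ≡ + 1) (sym t≡) (shift-one (triOdd j)))
                                      (shift-one-≢ _ t (λ e → odd≢even (trans (sym t≡) e))))
                , (λ t≡ → cong₂ ℤ._+_ (shift-one-≢ _ t (λ e → odd≢even (trans (sym e) t≡)))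
                                      (subst (λ s → shift (triEven j) one s ≡ + 1) (sym t≡) (shift-one (triEven j))))
                ]′ hit
    where
    odd≢even = ℕₚ.<⇒≢ (triOdd<triEven j)
  one-t≡0 : one t ≡ + 0
  one-t≡0 = positive t (ℕₚ.<-≤-trans (s≤s z≤n) lower)
    where
    positive : ∀ s → 0 < s → one s ≡ + 0
    positive (suc _) _ = refl

theta-miss : ∀ M t → 1 ≤ t → (∀ i → Misses t i) → theta M one t ≡ + 0
theta-miss M (suc t) _ misses = theta-misses 0 M (suc t) (λ i _ _ → misses i)

Δ-odd : ∀ j → Δ (suc (j + j)) ≡ triOdd j
Δ-odd j = trans (cong (_/ 2) (doubled j)) (m*n/n≡m (triOdd j) 2)
  where
  doubled : ∀ j → suc (j + j) * suc (suc (j + j)) ≡ suc j * suc (j + j) * 2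
  doubled = ℕ-Ring.solve-∀

Δ-even : ∀ j → Δ (suc (suc (j + j))) ≡ triEven j
Δ-even j = trans (cong (_/ 2) (doubled j)) (m*n/n≡m (triEven j) 2)
  where
  doubled : ∀ j → suc (suc (j + j)) * suc (suc (suc (j + j))) ≡ suc j * suc (suc (suc (j + j))) * 2
  doubled = ℕ-Ring.solve-∀

Δ[4k+1]≡triOdd : ∀ k → Δ (4 * k + 1) ≡ triOdd (k + k)
Δ[4k+1]≡triOdd k = trans (cong Δ (index k)) (Δ-odd (k + k))
  where
  index : ∀ k → 4 * k + 1 ≡ suc ((k + k) + (k + k))
  index = ℕ-Ring.solve-∀

Δ[4k+2]≡triEven : ∀ k → Δ (4 * k + 2) ≡ triEven (k + k)
Δ[4k+2]≡triEven k = trans (cong Δ (index k)) (Δ-even (k + k))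
  where
  index : ∀ k → 4 * k + 2 ≡ suc (suc ((k + k) + (k + k)))
  index = ℕ-Ring.solve-∀

Δ[4k+3]≡triOdd : ∀ k → Δ (4 * k + 3) ≡ triOdd (suc (k + k))
Δ[4k+3]≡triOdd k = trans (cong Δ (index k)) (Δ-odd (suc (k + k)))
  where
  index : ∀ k → 4 * k + 3 ≡ suc (suc (k + k) + suc (k + k))
  index = ℕ-Ring.solve-∀

Δ[4k+4]≡triEven : ∀ k → Δ (4 * k + 4) ≡ triEven (suc (k + k))
Δ[4k+4]≡triEven k = trans (cong Δ (index k)) (Δ-even (suc (k + k)))
  where
  index : ∀ k → 4 * k + 4 ≡ suc (suc (suc (k + k) + suc (k + k)))
  index = ℕ-Ring.solve-∀

theta-hit-2n : ∀ n j → 2 * n ≡ triOdd j ⊎ 2 * n ≡ triEven j → theta (n + n) one (2 * n) ≡ -1^ suc j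
theta-hit-2n n j hit = theta-hit (n + n) j (2 * n) j<2n hit
  where
  triOdd≤2n : triOdd j ≤ 2 * n
  triOdd≤2n = [ ℕₚ.≤-reflexive ∘ sym , (λ e → subst (triOdd j ≤_) (sym e) (ℕₚ.<⇒≤ (triOdd<triEven j))) ]′ hit
  j<2n : j < n + n
  j<2n = subst (j <_) (sym (y+y≡2*y n)) (ℕₚ.≤-trans (ℕₚ.m≤m*n (suc j) (suc (j + j))) triOdd≤2n)

theta-at-Δ4k+1∨2 : ∀ n → (∃ λ k → 2 * n ≡ Δ (4 * k + 1) ⊎ 2 * n ≡ Δ (4 * k + 2)) → theta (n + n) one (2 * n) ≡ ℤ.- (+ 1)
theta-at-Δ4k+1∨2 n (k , hit) =
  trans (theta-hit-2n n (k + k) (Sum.map (λ e → trans e (Δ[4k+1]≡triOdd k)) (λ e → trans e (Δ[4k+2]≡triEven k)) hit))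
        (cong ℤ.-_ (-1^-even k))

theta-at-Δ4k+3∨4 : ∀ n → (∃ λ k → 2 * n ≡ Δ (4 * k + 3) ⊎ 2 * n ≡ Δ (4 * k + 4)) → theta (n + n) one (2 * n) ≡ + 1
theta-at-Δ4k+3∨4 n (k , hit) =
  trans (theta-hit-2n n (suc (k + k)) (Sum.map (λ e → trans e (Δ[4k+3]≡triOdd k)) (λ e → trans e (Δ[4k+4]≡triEven k)) hit))
        (trans (ℤₚ.neg-involutive (-1^ (k + k))) (-1^-even k))

theta-off-Δ : ∀ n → 1 ≤ n →
              ¬ (∃ λ k → 2 * n ≡ Δ (4 * k + 1) ⊎ 2 * n ≡ Δ (4 * k + 2)) →
              ¬ (∃ λ k → 2 * n ≡ Δ (4 * k + 3) ⊎ 2 * n ≡ Δ (4 * k + 4)) →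
              theta (n + n) one (2 * n) ≡ + 0
theta-off-Δ n 1≤n no-1∨2 no-3∨4 = theta-miss (n + n) (2 * n) (ℕₚ.≤-trans 1≤n (ℕₚ.m≤n*m n 2)) misses
  where
  misses : ∀ i → Misses (2 * n) i
  misses i with even-or-odd i
  ... | k , inj₁ refl = (λ e → no-1∨2 (k , inj₁ (trans e (sym (Δ[4k+1]≡triOdd k)))))
                      , (λ e → no-1∨2 (k , inj₂ (trans e (sym (Δ[4k+2]≡triEven k)))))
  ... | k , inj₂ refl = (λ e → no-3∨4 (k , inj₁ (trans e (sym (Δ[4k+3]≡triOdd k)))))
                      , (λ e → no-3∨4 (k , inj₂ (trans e (sym (Δ[4k+4]≡triEven k)))))

q≡theta+partialSum : ∀ n N → 2 * n ≤ N → + q n ≡ theta (n + n) one (2 * n) ℤ.+ partialSum n N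
q≡theta+partialSum n N 2n≤N = begin
  + q n
    ≡⟨ move (+ q n) (partialSum n N) ⟩
  (+ q n ℤ.- partialSum n N) ℤ.+ partialSum n N
    ≡⟨ cong (ℤ._+ partialSum n N) coefficient ⟩
  theta M one (2 * n) ℤ.+ partialSum n N ∎
  where
  open ≡-Reasoning
  M = n + n
  g = plusEvenProd M one
  2n≤2M : 2 * n ≤ M + M
  2n≤2M = subst (_≤ M + M) (y+y≡2*y n) (ℕₚ.m≤m+n M M)
  move : ∀ a b → a ≡ (a ℤ.- b) ℤ.+ b
  move = solve-∀
  coefficient : + q n ℤ.- partialSum n N ≡ theta M one (2 * n)
  coefficient = begin
    + q n ℤ.- partialSum n N          ≡⟨ pentagonalSum-coeff M n N (ℕₚ.m≤m+n n n) ⟨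
    pentagonalSum N g (2 * n)         ≡⟨ pentagonalSum-stable N g (2 * n) 2n≤N ⟩
    pentagonalSum (2 * n) g (2 * n)   ≡⟨ pentagonalSum-stable (M + M) g (2 * n) 2n≤2M ⟨
    pentagonalSum (M + M) g (2 * n)   ≡⟨ eulerProd≈pentagonalSum (M + M) g (2 * n) 2n≤2M ⟨
    eulerProd (M + M) g (2 * n)       ≡⟨ eulerProd∘plusEvenProd≈theta M one (2 * n) 2n≤2M ⟩
    theta M one (2 * n)               ∎

theorem5 : (n : ℕ) → 1 ≤ n → (N : ℕ) → 2 * n ≤ N →
    ((∃ λ k → 2 * n ≡ Δ (4 * k + 1) ⊎ 2 * n ≡ Δ (4 * k + 2)) →
        + (q n) ≡ ℤ.- (+ 1) ℤ.+ partialSum n N)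
    × ((∃ λ k → 2 * n ≡ Δ (4 * k + 3) ⊎ 2 * n ≡ Δ (4 * k + 4)) →
        + (q n) ≡ + 1 ℤ.+ partialSum n N)
    × (¬ (∃ λ k → 2 * n ≡ Δ (4 * k + 1) ⊎ 2 * n ≡ Δ (4 * k + 2)) →
       ¬ (∃ λ k → 2 * n ≡ Δ (4 * k + 3) ⊎ 2 * n ≡ Δ (4 * k + 4)) →
        + (q n) ≡ partialSum n N)
theorem5 n 1≤n N 2n≤N =
    (λ hit → with-theta (theta-at-Δ4k+1∨2 n hit))
  , (λ hit → with-theta (theta-at-Δ4k+3∨4 n hit))
  , (λ no-1∨2 no-3∨4 → trans (with-theta (theta-off-Δ n 1≤n no-1∨2 no-3∨4)) (ℤₚ.+-identityˡ (partialSum n N)))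
  where
  with-theta : ∀ {v} → theta (n + n) one (2 * n) ≡ v → + q n ≡ v ℤ.+ partialSum n N
  with-theta θ≡v = trans (q≡theta+partialSum n N 2n≤N) (cong (λ x → x ℤ.+ partialSum n N) θ≡v)
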